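{- The set of near superperfect positive integers has natural density $0$.
   Context: $\sigma(m)$ denotes the sum of the positive divisors of $m$. A positive integer $n$ is near superperfect if $2n+d=\sigma(\sigma(n))$ for some positive divisor $d$ of $n$. -}

module Defs where

open import Data.Nat using (ℕ; zero; suc; _+_; _*_; _≤_; _<_; z≤n; s≤s)
open import Data.Nat.Properties using (_≟_; _<?_)
open import Data.Nat.Divisibility using (_∣_; _∣?_; ∣⇒≤)
open import Data.List using (List; filter; length; upTo)
open import Data.Nat.ListAction using (sum)
open import Data.Fin using (Fin; toℕ; fromℕ<)
open import Data.Fin.Properties using (any?; toℕ-fromℕ<)
open import Data.Product using (∃; ∃-syntax; _×_; _,_)
open import Relation.Nullary using (Dec; yes; no)
open import Relation.Nullary.Decidable using (_×-dec_)
open import Relation.Binary.PropositionalEquality using (_≡_; subst; sym)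

-- σ m : sum of the positive divisors of m (divisors of m among 1..m;
-- for m = 0 this is the empty sum, irrelevant here since σ n > 0 for n > 0).
σ : ℕ → ℕ
σ m = sum (filter (λ d → (0 <? d) ×-dec (d ∣? m)) (upTo (suc m)))

NearSuperperfect : ℕ → Set
NearSuperperfect n = 0 < n × ∃[ d ] (0 < d × d ∣ n × 2 * n + d ≡ σ (σ n))

nearSuperperfect? : (n : ℕ) → Dec (NearSuperperfect n)
nearSuperperfect? zero = no λ { (() , _) }
nearSuperperfect? (suc m) with any? {n = suc (suc m)} (λ i → (0 <? toℕ i) ×-dec ((toℕ i ∣? suc m) ×-dec (2 * suc m + toℕ i ≟ σ (σ (suc m)))))
... | yes (i , p) = yes (s≤s z≤n , toℕ i , p)
... | no ¬p = no λ { (_ , d , d>0 , d∣n , eq) →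
        let lt = s≤s (∣⇒≤ d∣n)
            e = sym (toℕ-fromℕ< lt)
        in ¬p (fromℕ< lt , subst (λ k → 0 < k × k ∣ suc m × 2 * suc m + k ≡ σ (σ (suc m))) e (d>0 , d∣n , eq)) }

countNSP : ℕ → ℕ
countNSP x = length (filter nearSuperperfect? (upTo (suc x)))

-- natural density 0, expressed with ε = 1/k: for every k ≥ 1, eventually
-- countNSP x / x ≤ 1/k.

{-# OPTIONS --safe #-}
-- If 2n + d = σ (σ n) with d ∣ n, then for odd n the right-hand side is odd, and σ m is
-- odd only when m is a square or twice a square; so σ n has that form. For even n with
-- σ n even, σ (σ n) > 3n ≥ 2n + d, so σ n is odd and n itself has that form. Squares and
-- twice squares up to x are O(√x), so it remains to count the n ≤ x for which σ n is a
-- square or twice a square. Fix W and Y = W². Either i² ∣ n for some i > W, which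
-- happens for at most ∑_{i>W} x/i² ≤ x/W values of n; or n = kp with p ≥ Y prime,
-- p ∤ k and (p + 1) σ k or 2 (p + 1) σ k a square, so p + 1 runs through a set a₀ w²
-- depending only on k, and summing over k gives O(x/W); or all prime factors of n are
-- below Y and all square divisors are at most Y, whence n ≤ Y! · Y. Altogether
-- W · #{n ≤ x} ≤ 9x + O_W(1).

module Submission where

open import Defs
open import Data.Nat
open import Data.Nat.Properties
open import Data.Nat.Divisibility
open import Data.Nat.DivMod using (_/_; m/n*n≡m; m*n/n≡m; /-monoˡ-≤; m/n*n≤m; n/1≡n; /-congʳ)
open import Data.Nat.Coprimality as Coprime using (Coprime; coprime-divisor; coprime-/gcd)
open import Data.Nat.GCD using (gcd; gcd[m,n]∣m; gcd[m,n]∣n; gcd[m,n]≢0)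
open import Data.Nat.Primality using (Prime; prime?; prime[2]; prime⇒irreducible; prime⇒nonTrivial; prime⇒nonZero)
open import Data.Nat.Primality.Factorisation using (factorise)
open import Data.Nat.Induction using (<-rec)
open import Data.Nat.ListAction using (sum; product)
open import Data.Nat.ListAction.Properties using (sum-++)
open import Data.List using ([]; _∷_; [_]; _++_; filter; length; upTo)
open import Data.List.Properties using (upTo-∷ʳ; length-++; filter-++)
open import Data.List.Relation.Unary.All using (_∷_)
open import Data.Product using (∃-syntax; _×_; _,_; proj₁; proj₂)
open import Data.Sum using (_⊎_; inj₁; inj₂)
open import Function using (_∘_; id; case_of_)
open import Relation.Nullary using (Dec; yes; no; ¬_; contradiction)
open import Relation.Nullary.Decidable using (_×-dec_; _⊎-dec_)
open import Relation.Unary using (Decidable)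
open import Relation.Binary.Definitions using (tri<; tri≈; tri>)
open import Relation.Binary.PropositionalEquality hiding ([_])
open import Algebra.Properties.CommutativeSemigroup *-commutativeSemigroup using (x∙yz≈y∙xz; x∙yz≈y∙zx)
open import Data.Nat.Solver using (module +-*-Solver)
open +-*-Solver

private variable
  P Q : Set

-- Indicators and finite sums

χ : Dec P → ℕ
χ (yes _) = 1
χ (no _)  = 0

χ≤1 : (p? : Dec P) → χ p? ≤ 1
χ≤1 (yes _) = ≤-refl
χ≤1 (no _)  = z≤n

χ-yes : (p? : Dec P) → P → χ p? ≡ 1
χ-yes (yes _) _ = refl
χ-yes (no ¬p) p = contradiction p ¬p

χ-no : (p? : Dec P) → ¬ P → χ p? ≡ 0
χ-no (yes p) ¬p = contradiction p ¬p
χ-no (no _)  _  = refl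

χ-mono : (p? : Dec P) (q? : Dec Q) → (P → Q) → χ p? ≤ χ q?
χ-mono (yes p) q? f = ≤-reflexive (sym (χ-yes q? (f p)))
χ-mono (no _)  _  _ = z≤n

χ-cong : (p? : Dec P) (q? : Dec Q) → (P → Q) → (Q → P) → χ p? ≡ χ q?
χ-cong p? q? f g = ≤-antisym (χ-mono p? q? f) (χ-mono q? p? g)

χ-≤ : (p? : Dec P) {m : ℕ} → (P → 1 ≤ m) → χ p? ≤ m
χ-≤ (yes p) 1≤m = 1≤m p
χ-≤ (no _)  _   = z≤n

χ-⊎ : (p? : Dec P) (q? : Dec Q) → χ (p? ⊎-dec q?) ≤ χ p? + χ q?
χ-⊎ (yes _) _       = s≤s z≤n
χ-⊎ (no _)  (yes _) = ≤-refl
χ-⊎ (no _)  (no _)  = z≤n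

χ-× : (p? : Dec P) (q? : Dec Q) → χ (p? ×-dec q?) ≡ χ p? * χ q?
χ-× (yes _) (yes _) = refl
χ-× (yes _) (no _)  = refl
χ-× (no _)  _       = refl

χ-*-yes : (p? : Dec P) → P → ∀ a → χ p? * a ≡ a
χ-*-yes p? p a = trans (cong (_* a) (χ-yes p? p)) (*-identityˡ a)

χ-*-no : (p? : Dec P) → ¬ P → ∀ a → χ p? * a ≡ 0
χ-*-no p? ¬p a = cong (_* a) (χ-no p? ¬p)

χ-*-monoʳ-≤ : (p? : Dec P) {a b : ℕ} → (P → a ≤ b) → χ p? * a ≤ χ p? * b
χ-*-monoʳ-≤ (yes p) a≤b = *-monoʳ-≤ 1 (a≤b p)
χ-*-monoʳ-≤ (no _)  _   = z≤n

∑ : ℕ → (ℕ → ℕ) → ℕ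
∑ zero    f = 0
∑ (suc n) f = ∑ n f + f n

∑-cong : ∀ n {f g : ℕ → ℕ} → (∀ i → i < n → f i ≡ g i) → ∑ n f ≡ ∑ n g
∑-cong zero    _ = refl
∑-cong (suc n) h = cong₂ _+_ (∑-cong n (λ i i<n → h i (m<n⇒m<1+n i<n))) (h n ≤-refl)

∑-mono-≤ : ∀ n {f g : ℕ → ℕ} → (∀ i → i < n → f i ≤ g i) → ∑ n f ≤ ∑ n g
∑-mono-≤ zero    _ = z≤n
∑-mono-≤ (suc n) h = +-mono-≤ (∑-mono-≤ n (λ i i<n → h i (m<n⇒m<1+n i<n))) (h n ≤-refl)

∑-zero : ∀ n {f : ℕ → ℕ} → (∀ i → i < n → f i ≡ 0) → ∑ n f ≡ 0
∑-zero zero    _ = refl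
∑-zero (suc n) h = cong₂ _+_ (∑-zero n (λ i i<n → h i (m<n⇒m<1+n i<n))) (h n ≤-refl)

∑-distrib-+ : ∀ n (f g : ℕ → ℕ) → ∑ n (λ i → f i + g i) ≡ ∑ n f + ∑ n g
∑-distrib-+ zero    f g = refl
∑-distrib-+ (suc n) f g = trans (cong (_+ (f n + g n)) (∑-distrib-+ n f g))
  (solve 4 (λ a b c d → a :+ b :+ (c :+ d) := a :+ c :+ (b :+ d)) refl (∑ n f) (∑ n g) (f n) (g n))

∑-*ˡ : ∀ n c (f : ℕ → ℕ) → ∑ n (λ i → c * f i) ≡ c * ∑ n f
∑-*ˡ zero    c f = sym (*-zeroʳ c)
∑-*ˡ (suc n) c f = trans (cong (_+ c * f n) (∑-*ˡ n c f)) (sym (*-distribˡ-+ c (∑ n f) (f n)))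

∑-*ʳ : ∀ n c (f : ℕ → ℕ) → ∑ n (λ i → f i * c) ≡ ∑ n f * c
∑-*ʳ n c f = trans (∑-cong n (λ i _ → *-comm (f i) c)) (trans (∑-*ˡ n c f) (*-comm c (∑ n f)))

∑-product : ∀ n m (f g : ℕ → ℕ) → ∑ n f * ∑ m g ≡ ∑ n (λ i → ∑ m (λ j → f i * g j))
∑-product n m f g = trans (sym (∑-*ʳ n (∑ m g) f)) (∑-cong n (λ i _ → sym (∑-*ˡ m (f i) g)))

∑-comm : ∀ n m (f : ℕ → ℕ → ℕ) → ∑ n (λ i → ∑ m (f i)) ≡ ∑ m (λ j → ∑ n (λ i → f i j))
∑-comm zero    m f = sym (∑-zero m (λ _ _ → refl))
∑-comm (suc n) m f = trans (cong (_+ ∑ m (f n)) (∑-comm n m f))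
                           (sym (∑-distrib-+ m (λ j → ∑ n (λ i → f i j)) (f n)))

∑-+ : ∀ m n (f : ℕ → ℕ) → ∑ (m + n) f ≡ ∑ m f + ∑ n (λ j → f (m + j))
∑-+ m zero    f = trans (cong (λ k → ∑ k f) (+-identityʳ m)) (sym (+-identityʳ (∑ m f)))
∑-+ m (suc n) f = begin
  ∑ (m + suc n) f                         ≡⟨ cong (λ k → ∑ k f) (+-suc m n) ⟩
  ∑ (m + n) f + f (m + n)                 ≡⟨ cong (_+ f (m + n)) (∑-+ m n f) ⟩
  ∑ m f + ∑ n (λ j → f (m + j)) + f (m + n) ≡⟨ +-assoc (∑ m f) _ _ ⟩
  ∑ m f + ∑ (suc n) (λ j → f (m + j))     ∎
  where open ≡-Reasoning

∑-split-parity : ∀ n (f : ℕ → ℕ) → ∑ (2 * n) f ≡ ∑ n (λ h → f (2 * h)) + ∑ n (λ h → f (suc (2 * h)))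
∑-split-parity zero    f = refl
∑-split-parity (suc n) f = begin
  ∑ (2 * suc n) f                   ≡⟨ cong (λ k → ∑ k f) (*-suc 2 n) ⟩
  ∑ (2 * n) f + f (2 * n) + f (suc (2 * n))
    ≡⟨ cong (λ s → s + f (2 * n) + f (suc (2 * n))) (∑-split-parity n f) ⟩
  E + O + f (2 * n) + f (suc (2 * n))
    ≡⟨ solve 4 (λ e o x y → e :+ o :+ x :+ y := e :+ x :+ (o :+ y)) refl E O (f (2 * n)) (f (suc (2 * n))) ⟩
  (E + f (2 * n)) + (O + f (suc (2 * n))) ∎
  where
  open ≡-Reasoning
  E = ∑ n (λ h → f (2 * h))
  O = ∑ n (λ h → f (suc (2 * h)))

∑-monoˡ-≤ : ∀ {m n} (f : ℕ → ℕ) → m ≤ n → ∑ m f ≤ ∑ n f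
∑-monoˡ-≤ {m} {zero}  f z≤n = ≤-refl
∑-monoˡ-≤ {m} {suc n} f m≤1+n with m≤n⇒m<n∨m≡n m≤1+n
... | inj₁ m<1+n = ≤-trans (∑-monoˡ-≤ f (≤-pred m<1+n)) (m≤m+n (∑ n f) (f n))
... | inj₂ refl  = ≤-refl

f≤∑ : ∀ n (f : ℕ → ℕ) {i} → i < n → f i ≤ ∑ n f
f≤∑ n f {i} i<n = ≤-trans (m≤n+m (f i) (∑ i f)) (∑-monoˡ-≤ f i<n)

∑-≤-const : ∀ n c {f : ℕ → ℕ} → (∀ i → i < n → f i ≤ c) → ∑ n f ≤ n * c
∑-≤-const zero    c h = z≤n
∑-≤-const (suc n) c {f} h = subst (∑ n f + f n ≤_) (+-comm (n * c) c)
  (+-mono-≤ (∑-≤-const n c (λ i i<n → h i (m<n⇒m<1+n i<n))) (h n ≤-refl))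

∑-≤-support : ∀ N M {f : ℕ → ℕ} → (∀ k → M < k → f k ≡ 0) → ∑ N f ≤ ∑ (suc M) f
∑-≤-support zero    M     h = z≤n
∑-≤-support (suc N) M {f} h with N ≤? M
... | yes N≤M = ∑-monoˡ-≤ f (s≤s N≤M)
... | no  N≰M = subst (_≤ ∑ (suc M) f) (sym (trans (cong (∑ N f +_) (h N (≰⇒> N≰M))) (+-identityʳ _)))
                      (∑-≤-support N M h)

∑-multiples-≤ : ∀ r n (f : ℕ → ℕ) → 0 < r → ∑ n (λ d → f (r * d)) ≤ ∑ (r * n) f
∑-multiples-≤ r zero    f _   = z≤n
∑-multiples-≤ r (suc n) f r>0 = begin
  ∑ n (λ d → f (r * d)) + f (r * n) ≤⟨ +-monoˡ-≤ (f (r * n)) (∑-multiples-≤ r n f r>0) ⟩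
  ∑ (suc (r * n)) f                 ≤⟨ ∑-monoˡ-≤ f (subst (suc (r * n) ≤_) (sym (*-suc r n)) (+-monoˡ-≤ (r * n) r>0)) ⟩
  ∑ (r * suc n) f                   ∎
  where open ≤-Reasoning

∑-∣ : ∀ {d} n (f : ℕ → ℕ) → (∀ i → i < n → d ∣ f i) → d ∣ ∑ n f
∑-∣ zero    f _ = _ ∣0
∑-∣ (suc n) f h = ∣m∣n⇒∣m+n (∑-∣ n f (λ i i<n → h i (m<n⇒m<1+n i<n))) (h n ≤-refl)

∑-point : ∀ n c (f : ℕ → ℕ) → c < n → ∑ n (λ i → χ (i ≟ c) * f i) ≡ f c
∑-point (suc n) c f c<1+n with m≤n⇒m<n∨m≡n (≤-pred c<1+n)
... | inj₁ c<n = trans (cong₂ _+_ (∑-point n c f c<n) (χ-*-no (n ≟ c) (>⇒≢ c<n) (f n)))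
                       (+-identityʳ (f c))
... | inj₂ refl = cong₂ _+_ (∑-zero n (λ i i<n → χ-*-no (i ≟ n) (<⇒≢ i<n) (f i)))
                            (χ-*-yes (n ≟ n) refl (f n))

∑-point-≤ : ∀ n c (f : ℕ → ℕ) → ∑ n (λ i → χ (i ≟ c) * f i) ≤ f c
∑-point-≤ n c f with c <? n
... | yes c<n = ≤-reflexive (∑-point n c f c<n)
... | no  c≮n = ≤-trans (≤-reflexive (∑-zero n (λ i i<n → χ-*-no (i ≟ c) (λ { refl → c≮n i<n }) (f i))))
                        z≤n

∑-point-scaled : ∀ n c v → v < n ⊎ c ≡ 0 → ∑ n (λ e → χ (e ≟ v) * (c * e)) ≡ c * v
∑-point-scaled n c v (inj₁ v<n) = ∑-point n v (c *_) v<n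
∑-point-scaled n c v (inj₂ refl) = ∑-zero n (λ e _ → *-zeroʳ (χ (e ≟ v)))

∑-χ-≟ : ∀ n c → c < n → ∑ n (λ i → χ (i ≟ c)) ≡ 1
∑-χ-≟ n c c<n = trans (∑-cong n (λ i _ → sym (*-identityʳ (χ (i ≟ c))))) (∑-point n c (λ _ → 1) c<n)

∑-χ-≟-≤ : ∀ n c → ∑ n (λ i → χ (i ≟ c)) ≤ 1
∑-χ-≟-≤ n c = subst (_≤ 1) (∑-cong n (λ i _ → *-identityʳ (χ (i ≟ c)))) (∑-point-≤ n c (λ _ → 1))

∑-≟-const : ∀ x v a → ∑ (suc x) (λ n → χ (n ≟ v) * a) ≡ χ (v ≤? x) * a
∑-≟-const x v a with v ≤? x
... | yes v≤x = trans (∑-point (suc x) v (λ _ → a) (s≤s v≤x)) (sym (*-identityˡ a))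
... | no  v≰x = ∑-zero (suc x) (λ n n≤x → χ-*-no (n ≟ v) (λ { refl → v≰x (≤-pred n≤x) }) a)

∑-χ-0< : ∀ M → ∑ (suc M) (λ k → χ (0 <? k)) ≡ M
∑-χ-0< zero    = refl
∑-χ-0< (suc M) = trans (cong (_+ 1) (∑-χ-0< M)) (+-comm M 1)

fibre : (ℕ → ℕ → ℕ) → (ℕ → ℕ → ℕ) → ℕ → ℕ → ℕ
fibre φ g M n = ∑ M (λ a → ∑ M (λ b → χ (n ≟ φ a b) * g a b))

≤-fibre : ∀ (φ g : ℕ → ℕ → ℕ) M {n a b t} → a < M → b < M → n ≡ φ a b → t ≤ g a b → t ≤ fibre φ g M n
≤-fibre φ g M {n} {a} {b} a<M b<M n≡φab t≤gab = begin
  _                                       ≤⟨ t≤gab ⟩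
  g a b                                   ≡⟨ χ-*-yes (n ≟ φ a b) n≡φab (g a b) ⟨
  χ (n ≟ φ a b) * g a b                   ≤⟨ f≤∑ M (λ b → χ (n ≟ φ a b) * g a b) b<M ⟩
  ∑ M (λ b → χ (n ≟ φ a b) * g a b)       ≤⟨ f≤∑ M (λ a → ∑ M (λ b → χ (n ≟ φ a b) * g a b)) a<M ⟩
  fibre φ g M n                           ∎
  where open ≤-Reasoning

∑-fibre : ∀ x (φ g : ℕ → ℕ → ℕ) M → ∑ (suc x) (fibre φ g M) ≡ ∑ M (λ a → ∑ M (λ b → χ (φ a b ≤? x) * g a b))
∑-fibre x φ g M = begin
  ∑ (suc x) (λ n → ∑ M (λ a → ∑ M (λ b → χ (n ≟ φ a b) * g a b)))   ≡⟨ ∑-comm (suc x) M _ ⟩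
  ∑ M (λ a → ∑ (suc x) (λ n → ∑ M (λ b → χ (n ≟ φ a b) * g a b)))   ≡⟨ ∑-cong M (λ a _ → ∑-comm (suc x) M _) ⟩
  ∑ M (λ a → ∑ M (λ b → ∑ (suc x) (λ n → χ (n ≟ φ a b) * g a b)))
    ≡⟨ ∑-cong M (λ a _ → ∑-cong M (λ b _ → ∑-≟-const x (φ a b) (g a b))) ⟩
  ∑ M (λ a → ∑ M (λ b → χ (φ a b ≤? x) * g a b))                    ∎
  where open ≡-Reasoning

module _ {P : ℕ → Set} (P? : Decidable P) where

  length-filter-upTo : ∀ n → length (filter P? (upTo n)) ≡ ∑ n (λ i → χ (P? i))
  length-filter-upTo zero    = refl
  length-filter-upTo (suc n) = begin
    length (filter P? (upTo (suc n)))                   ≡⟨ cong (length ∘ filter P?) (upTo-∷ʳ n) ⟨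
    length (filter P? (upTo n ++ [ n ]))                ≡⟨ cong length (filter-++ P? (upTo n) [ n ]) ⟩
    length (filter P? (upTo n) ++ filter P? [ n ])      ≡⟨ length-++ (filter P? (upTo n)) ⟩
    length (filter P? (upTo n)) + length (filter P? [ n ]) ≡⟨ cong₂ _+_ (length-filter-upTo n) (last n) ⟩
    ∑ n (λ i → χ (P? i)) + χ (P? n)                     ∎
    where
    open ≡-Reasoning
    last : ∀ n → length (filter P? [ n ]) ≡ χ (P? n)
    last n with P? n
    ... | yes _ = refl
    ... | no  _ = refl

  sum-filter-upTo : ∀ n → sum (filter P? (upTo n)) ≡ ∑ n (λ i → χ (P? i) * i)
  sum-filter-upTo zero    = refl
  sum-filter-upTo (suc n) = begin
    sum (filter P? (upTo (suc n)))                ≡⟨ cong (sum ∘ filter P?) (upTo-∷ʳ n) ⟨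
    sum (filter P? (upTo n ++ [ n ]))             ≡⟨ cong sum (filter-++ P? (upTo n) [ n ]) ⟩
    sum (filter P? (upTo n) ++ filter P? [ n ])   ≡⟨ sum-++ (filter P? (upTo n)) _ ⟩
    sum (filter P? (upTo n)) + sum (filter P? [ n ]) ≡⟨ cong₂ _+_ (sum-filter-upTo n) (last n) ⟩
    ∑ n (λ i → χ (P? i) * i) + χ (P? n) * n       ∎
    where
    open ≡-Reasoning
    last : ∀ n → sum (filter P? [ n ]) ≡ χ (P? n) * n
    last n with P? n
    ... | yes _ = refl
    ... | no  _ = refl

-- Divisor sums

m*n>0⇒m>0 : ∀ m {n} → 0 < m * n → 0 < m
m*n>0⇒m>0 (suc _) _ = z<s

m*n>0⇒n>0 : ∀ m {n} → 0 < m * n → 0 < n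
m*n>0⇒n>0 m {n} = m*n>0⇒m>0 n ∘ subst (0 <_) (*-comm m n)

∣⇒≤′ : ∀ {d m} → 0 < m → d ∣ m → d ≤ m
∣⇒≤′ {m = suc _} _ = ∣⇒≤

n≤n*n : ∀ n → n ≤ n * n
n≤n*n zero    = z≤n
n≤n*n (suc n) = m≤m*n (suc n) (suc n)

𝟙[_∣_] : ℕ → ℕ → ℕ
𝟙[ d ∣ m ] = χ ((0 <? d) ×-dec (d ∣? m))

𝟙-∣ : ∀ {d m} → 0 < d → d ∣ m → 𝟙[ d ∣ m ] ≡ 1
𝟙-∣ {d} {m} d>0 d∣m = χ-yes ((0 <? d) ×-dec (d ∣? m)) (d>0 , d∣m)

𝟙-∤ : ∀ {d m} → ¬ d ∣ m → 𝟙[ d ∣ m ] ≡ 0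
𝟙-∤ {d} {m} d∤m = χ-no ((0 <? d) ×-dec (d ∣? m)) (d∤m ∘ proj₂)

𝟙-case : ∀ d m → 𝟙[ d ∣ m ] ≡ 0 ⊎ (0 < d × d ∣ m)
𝟙-case d m with (0 <? d) ×-dec (d ∣? m)
... | yes p = inj₂ p
... | no  _ = inj₁ refl

σ≡∑ : ∀ m → σ m ≡ ∑ (suc m) (λ d → 𝟙[ d ∣ m ] * d)
σ≡∑ m = sum-filter-upTo (λ d → (0 <? d) ×-dec (d ∣? m)) (suc m)

gcd-cofactors : ∀ x y → 0 < x →
                ∃[ g ] ∃[ x′ ] ∃[ y′ ] (0 < g × x ≡ x′ * g × y ≡ y′ * g × Coprime x′ y′)
gcd-cofactors x y x>0 =
  g , x / g , y / g , >-nonZero⁻¹ g ,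
  sym (m/n*n≡m (gcd[m,n]∣m x y)) , sym (m/n*n≡m (gcd[m,n]∣n x y)) , coprime-/gcd x y
  where
  g = gcd x y
  instance
    g≢0 : NonZero g
    g≢0 = ≢-nonZero (gcd[m,n]≢0 x y (inj₁ (n>0⇒n≢0 x>0)))

coprime-∣-split : ∀ {a b e} → 0 < a → Coprime a b → e ∣ a * b →
                  ∃[ e₁ ] ∃[ e₂ ] (e₁ ∣ a × e₂ ∣ b × e ≡ e₁ * e₂)
coprime-∣-split {a} {b} {e} a>0 a⊥b e∣ab with gcd-cofactors a e a>0
... | g , a′ , e′ , g>0 , refl , refl , a′⊥e′ = g , e′ , n∣m*n a′ , e′∣b , *-comm e′ g
  where
  instance
    g≢0 : NonZero g
    g≢0 = >-nonZero g>0
  e′∣a′b : e′ ∣ a′ * b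
  e′∣a′b = *-cancelʳ-∣ g (subst (e′ * g ∣_) (solve 3 (λ x y z → x :* y :* z := x :* z :* y) refl a′ g b) e∣ab)
  e′∣b : e′ ∣ b
  e′∣b = coprime-divisor (Coprime.sym a′⊥e′) e′∣a′b

coprime-∣-unique : ∀ {a b d₁ d₂ e₁ e₂} → Coprime a b → d₁ ∣ a → e₁ ∣ a → d₂ ∣ b → e₂ ∣ b →
                   d₁ * d₂ ≡ e₁ * e₂ → d₁ ≡ e₁
coprime-∣-unique {a} {b} {d₁} {d₂} {e₁} {e₂} a⊥b d₁∣a e₁∣a d₂∣b e₂∣b eq =
  ∣-antisym (coprime-divisor (⊥-sub d₁∣a e₂∣b) (divides d₂ (trans (*-comm e₂ e₁) (sym (trans (*-comm d₂ d₁) eq)))))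
            (coprime-divisor (⊥-sub e₁∣a d₂∣b) (divides e₂ (trans (*-comm d₂ d₁) (trans eq (*-comm e₁ e₂)))))
  where
  ⊥-sub : ∀ {x y} → x ∣ a → y ∣ b → Coprime x y
  ⊥-sub x∣a y∣b (i∣x , i∣y) = a⊥b (∣-trans i∣x x∣a , ∣-trans i∣y y∣b)

module _ (a b e : ℕ) where

  factorisation? : ∀ d₁ d₂ → Dec (e ≡ d₁ * d₂ × (0 < d₁ × d₁ ∣ a) × (0 < d₂ × d₂ ∣ b))
  factorisation? d₁ d₂ = (e ≟ d₁ * d₂) ×-dec ((0 <? d₁) ×-dec (d₁ ∣? a)) ×-dec ((0 <? d₂) ×-dec (d₂ ∣? b))

  factorisation-term : ∀ d₁ d₂ → χ (e ≟ d₁ * d₂) * (𝟙[ d₁ ∣ a ] * 𝟙[ d₂ ∣ b ]) ≡ χ (factorisation? d₁ d₂)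
  factorisation-term d₁ d₂ = sym (trans (χ-× (e ≟ d₁ * d₂) _) (cong (χ (e ≟ d₁ * d₂) *_) (χ-× ((0 <? d₁) ×-dec (d₁ ∣? a)) _)))

coprime-factorisations : ∀ {a b e} → 0 < a → 0 < b → Coprime a b → 0 < e →
  ∑ (suc a) (λ d₁ → ∑ (suc b) (λ d₂ → χ (e ≟ d₁ * d₂) * (𝟙[ d₁ ∣ a ] * 𝟙[ d₂ ∣ b ]))) ≡ 𝟙[ e ∣ a * b ]
coprime-factorisations {a} {b} {e} a>0 b>0 a⊥b e>0 with e ∣? a * b
... | no e∤ab = trans (∑-zero (suc a) (λ d₁ _ → ∑-zero (suc b) (λ d₂ _ →
                        trans (factorisation-term a b e d₁ d₂) (χ-no (factorisation? a b e d₁ d₂) impossible))))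
                      (sym (χ-no _ (e∤ab ∘ proj₂)))
  where
  impossible : ∀ {d₁ d₂} → ¬ (e ≡ d₁ * d₂ × (0 < d₁ × d₁ ∣ a) × (0 < d₂ × d₂ ∣ b))
  impossible (refl , (_ , d₁∣a) , (_ , d₂∣b)) = e∤ab (*-pres-∣ d₁∣a d₂∣b)
... | yes e∣ab with coprime-∣-split a>0 a⊥b e∣ab
...   | g₁ , g₂ , g₁∣a , g₂∣b , refl = trans count (sym (χ-yes _ (e>0 , e∣ab)))
  where
  open ≡-Reasoning
  to : ∀ {d₁ d₂} → g₁ * g₂ ≡ d₁ * d₂ × (0 < d₁ × d₁ ∣ a) × (0 < d₂ × d₂ ∣ b) → d₁ ≡ g₁ × d₂ ≡ g₂
  to {d₁} {d₂} (eq , (d₁>0 , d₁∣a) , (_ , d₂∣b)) =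
    d₁≡g₁ , *-cancelˡ-≡ d₂ g₂ d₁ {{>-nonZero d₁>0}} (trans (sym eq) (cong (_* g₂) (sym d₁≡g₁)))
    where
    d₁≡g₁ : d₁ ≡ g₁
    d₁≡g₁ = coprime-∣-unique a⊥b d₁∣a g₁∣a d₂∣b g₂∣b (sym eq)
  from : ∀ {d₁ d₂} → d₁ ≡ g₁ × d₂ ≡ g₂ → g₁ * g₂ ≡ d₁ * d₂ × (0 < d₁ × d₁ ∣ a) × (0 < d₂ × d₂ ∣ b)
  from (refl , refl) = refl , (m*n>0⇒m>0 g₁ e>0 , g₁∣a) , (m*n>0⇒n>0 g₁ e>0 , g₂∣b)
  count : ∑ (suc a) (λ d₁ → ∑ (suc b) (λ d₂ → χ (g₁ * g₂ ≟ d₁ * d₂) * (𝟙[ d₁ ∣ a ] * 𝟙[ d₂ ∣ b ]))) ≡ 1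
  count = begin
    ∑ (suc a) (λ d₁ → ∑ (suc b) (λ d₂ → χ (g₁ * g₂ ≟ d₁ * d₂) * (𝟙[ d₁ ∣ a ] * 𝟙[ d₂ ∣ b ])))
      ≡⟨ ∑-cong (suc a) (λ d₁ _ → ∑-cong (suc b) (λ d₂ _ →
           trans (factorisation-term a b e d₁ d₂) (trans (χ-cong _ _ to from) (χ-× (d₁ ≟ g₁) (d₂ ≟ g₂))))) ⟩
    ∑ (suc a) (λ d₁ → ∑ (suc b) (λ d₂ → χ (d₁ ≟ g₁) * χ (d₂ ≟ g₂)))
      ≡⟨ ∑-cong (suc a) (λ d₁ _ → trans (∑-*ˡ (suc b) (χ (d₁ ≟ g₁)) _)
                                         (cong (χ (d₁ ≟ g₁) *_) (∑-χ-≟ (suc b) g₂ (s≤s (∣⇒≤′ b>0 g₂∣b))))) ⟩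
    ∑ (suc a) (λ d₁ → χ (d₁ ≟ g₁) * 1)
      ≡⟨ ∑-point (suc a) g₁ (λ _ → 1) (s≤s (∣⇒≤′ a>0 g₁∣a)) ⟩
    1
      ∎

σ-*-coprime : ∀ {a b} → 0 < a → 0 < b → Coprime a b → σ (a * b) ≡ σ a * σ b
σ-*-coprime {a} {b} a>0 b>0 a⊥b = begin
  σ (a * b)
    ≡⟨ σ≡∑ (a * b) ⟩
  ∑ (suc (a * b)) (λ e → 𝟙[ e ∣ a * b ] * e)
    ≡⟨ ∑-cong (suc (a * b)) (λ e _ → count e) ⟨
  ∑ (suc (a * b)) (λ e → ∑ (suc a) (λ d₁ → ∑ (suc b) (λ d₂ → χ (e ≟ d₁ * d₂) * (t d₁ d₂ * e))))
    ≡⟨ ∑-comm (suc (a * b)) (suc a) _ ⟩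
  ∑ (suc a) (λ d₁ → ∑ (suc (a * b)) (λ e → ∑ (suc b) (λ d₂ → χ (e ≟ d₁ * d₂) * (t d₁ d₂ * e))))
    ≡⟨ ∑-cong (suc a) (λ d₁ _ → ∑-comm (suc (a * b)) (suc b) _) ⟩
  ∑ (suc a) (λ d₁ → ∑ (suc b) (λ d₂ → ∑ (suc (a * b)) (λ e → χ (e ≟ d₁ * d₂) * (t d₁ d₂ * e))))
    ≡⟨ ∑-cong (suc a) (λ d₁ _ → ∑-cong (suc b) (λ d₂ _ → ∑-point-scaled (suc (a * b)) (t d₁ d₂) (d₁ * d₂) (in-range d₁ d₂))) ⟩
  ∑ (suc a) (λ d₁ → ∑ (suc b) (λ d₂ → t d₁ d₂ * (d₁ * d₂)))
    ≡⟨ ∑-cong (suc a) (λ d₁ _ → ∑-cong (suc b) (λ d₂ _ → [m*n]*[o*p]≡[m*o]*[n*p] 𝟙[ d₁ ∣ a ] 𝟙[ d₂ ∣ b ] d₁ d₂)) ⟩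
  ∑ (suc a) (λ d₁ → ∑ (suc b) (λ d₂ → 𝟙[ d₁ ∣ a ] * d₁ * (𝟙[ d₂ ∣ b ] * d₂)))
    ≡⟨ ∑-product (suc a) (suc b) _ _ ⟨
  ∑ (suc a) (λ d₁ → 𝟙[ d₁ ∣ a ] * d₁) * ∑ (suc b) (λ d₂ → 𝟙[ d₂ ∣ b ] * d₂)
    ≡⟨ cong₂ _*_ (σ≡∑ a) (σ≡∑ b) ⟨
  σ a * σ b ∎
  where
  open ≡-Reasoning
  t : ℕ → ℕ → ℕ
  t d₁ d₂ = 𝟙[ d₁ ∣ a ] * 𝟙[ d₂ ∣ b ]
  in-range : ∀ d₁ d₂ → d₁ * d₂ < suc (a * b) ⊎ t d₁ d₂ ≡ 0
  in-range d₁ d₂ with 𝟙-case d₁ a | 𝟙-case d₂ b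
  ... | inj₁ 𝟙≡0 | _        = inj₂ (cong (_* 𝟙[ d₂ ∣ b ]) 𝟙≡0)
  ... | inj₂ _   | inj₁ 𝟙≡0 = inj₂ (trans (cong (𝟙[ d₁ ∣ a ] *_) 𝟙≡0) (*-zeroʳ 𝟙[ d₁ ∣ a ]))
  ... | inj₂ (_ , d₁∣a) | inj₂ (_ , d₂∣b) = inj₁ (s≤s (*-mono-≤ (∣⇒≤′ a>0 d₁∣a) (∣⇒≤′ b>0 d₂∣b)))
  count : ∀ e → ∑ (suc a) (λ d₁ → ∑ (suc b) (λ d₂ → χ (e ≟ d₁ * d₂) * (t d₁ d₂ * e))) ≡ 𝟙[ e ∣ a * b ] * e
  count zero    = trans (∑-zero (suc a) (λ d₁ _ → ∑-zero (suc b) (λ d₂ _ →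
                          trans (cong (χ (0 ≟ d₁ * d₂) *_) (*-zeroʳ (t d₁ d₂))) (*-zeroʳ (χ (0 ≟ d₁ * d₂))))))
                        (sym (*-zeroʳ 𝟙[ 0 ∣ a * b ]))
  count (suc e) = begin
    ∑ (suc a) (λ d₁ → ∑ (suc b) (λ d₂ → χ (suc e ≟ d₁ * d₂) * (t d₁ d₂ * suc e)))
      ≡⟨ ∑-cong (suc a) (λ d₁ _ → trans (∑-cong (suc b) (λ d₂ _ → sym (*-assoc (χ (suc e ≟ d₁ * d₂)) (t d₁ d₂) (suc e))))
                                          (∑-*ʳ (suc b) (suc e) _)) ⟩
    ∑ (suc a) (λ d₁ → ∑ (suc b) (λ d₂ → χ (suc e ≟ d₁ * d₂) * t d₁ d₂) * suc e)
      ≡⟨ ∑-*ʳ (suc a) (suc e) _ ⟩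
    ∑ (suc a) (λ d₁ → ∑ (suc b) (λ d₂ → χ (suc e ≟ d₁ * d₂) * t d₁ d₂)) * suc e
      ≡⟨ cong (_* suc e) (coprime-factorisations a>0 b>0 a⊥b z<s) ⟩
    𝟙[ suc e ∣ a * b ] * suc e ∎

𝟙-prime : ∀ {p} → Prime p → ∀ d → 𝟙[ d ∣ p ] ≡ χ (d ≟ 1) + χ (d ≟ p)
𝟙-prime {p} p-prime d with 𝟙-case d p | d ≟ 1 | d ≟ p
... | _ | yes refl | yes refl = contradiction (nonTrivial⇒n>1 1 {{prime⇒nonTrivial p-prime}}) (<-irrefl refl)
... | _ | yes refl | no _     = 𝟙-∣ z<s (1∣ p)
... | _ | no _     | yes refl = 𝟙-∣ (>-nonZero⁻¹ p {{prime⇒nonZero p-prime}}) ∣-refl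
... | inj₁ 𝟙≡0 | no _ | no _ = 𝟙≡0
... | inj₂ (_ , d∣p) | no d≢1 | no d≢p with prime⇒irreducible p-prime d∣p
...   | inj₁ d≡1 = contradiction d≡1 d≢1
...   | inj₂ d≡p = contradiction d≡p d≢p

σ-prime : ∀ {p} → Prime p → σ p ≡ suc p
σ-prime {p} p-prime = begin
  σ p                                                           ≡⟨ σ≡∑ p ⟩
  ∑ (suc p) (λ d → 𝟙[ d ∣ p ] * d)
    ≡⟨ ∑-cong (suc p) (λ d _ → trans (cong (_* d) (𝟙-prime p-prime d)) (*-distribʳ-+ d (χ (d ≟ 1)) (χ (d ≟ p)))) ⟩
  ∑ (suc p) (λ d → χ (d ≟ 1) * d + χ (d ≟ p) * d)               ≡⟨ ∑-distrib-+ (suc p) _ _ ⟩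
  ∑ (suc p) (λ d → χ (d ≟ 1) * d) + ∑ (suc p) (λ d → χ (d ≟ p) * d)
    ≡⟨ cong₂ _+_ (∑-point (suc p) 1 id (s≤s (<⇒≤ (nonTrivial⇒n>1 p {{prime⇒nonTrivial p-prime}})))) (∑-point (suc p) p id ≤-refl) ⟩
  suc p                                                         ∎
  where open ≡-Reasoning

σ-≥-suc : ∀ m → 2 ≤ m → suc m ≤ σ m
σ-≥-suc m m≥2 = begin
  suc m                                      ≡⟨ +-comm 1 m ⟩
  m + 1                                      ≡⟨ cong₂ _+_ (sym (χ-*-yes ((0 <? m) ×-dec (m ∣? m)) (<-trans z<s m≥2 , ∣-refl) m))
                                                            (sym (χ-*-yes ((0 <? 1) ×-dec (1 ∣? m)) (z<s , 1∣ m) 1)) ⟩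
  𝟙[ m ∣ m ] * m + 𝟙[ 1 ∣ m ] * 1           ≤⟨ +-monoʳ-≤ (𝟙[ m ∣ m ] * m) (f≤∑ m (λ d → 𝟙[ d ∣ m ] * d) m≥2) ⟩
  𝟙[ m ∣ m ] * m + ∑ m (λ d → 𝟙[ d ∣ m ] * d) ≡⟨ +-comm (𝟙[ m ∣ m ] * m) _ ⟩
  ∑ (suc m) (λ d → 𝟙[ d ∣ m ] * d)           ≡⟨ σ≡∑ m ⟨
  σ m                                        ∎
  where open ≤-Reasoning

σ-≥ : ∀ m → m ≤ σ m
σ-≥ 0             = z≤n
σ-≥ 1             = ≤-refl
σ-≥ m@(suc (suc _)) = <⇒≤ (σ-≥-suc m (s≤s (s≤s z≤n)))

*-σ-≤-σ-* : ∀ r c → 0 < r → 0 < c → r * σ c ≤ σ (r * c)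
*-σ-≤-σ-* r c r>0 c>0 = begin
  r * σ c                                              ≡⟨ cong (r *_) (σ≡∑ c) ⟩
  r * ∑ (suc c) (λ d → 𝟙[ d ∣ c ] * d)                 ≡⟨ ∑-*ˡ (suc c) r _ ⟨
  ∑ (suc c) (λ d → r * (𝟙[ d ∣ c ] * d))               ≤⟨ ∑-mono-≤ (suc c) (λ d _ → multiple-divides d) ⟩
  ∑ (suc c) (λ d → g (r * d))                          ≤⟨ ∑-multiples-≤ r (suc c) g r>0 ⟩
  ∑ (r * suc c) g                                      ≤⟨ ∑-≤-support (r * suc c) (r * c) beyond ⟩
  ∑ (suc (r * c)) g                                    ≡⟨ σ≡∑ (r * c) ⟨
  σ (r * c)                                            ∎
  where
  open ≤-Reasoning
  g : ℕ → ℕ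
  g e = 𝟙[ e ∣ r * c ] * e
  multiple-divides : ∀ d → r * (𝟙[ d ∣ c ] * d) ≤ g (r * d)
  multiple-divides d = subst (_≤ g (r * d)) (x∙yz≈y∙xz 𝟙[ d ∣ c ] r d)
    (*-monoˡ-≤ (r * d) (χ-mono ((0 <? d) ×-dec (d ∣? c)) ((0 <? r * d) ×-dec (r * d ∣? r * c))
                               (λ (d>0 , d∣c) → *-mono-< r>0 d>0 , *-monoʳ-∣ r d∣c)))
  beyond : ∀ e → r * c < e → g e ≡ 0
  beyond e rc<e = χ-*-no ((0 <? e) ×-dec (e ∣? r * c)) (λ (_ , e∣rc) → <⇒≱ rc<e (∣⇒≤′ (*-mono-< r>0 c>0) e∣rc)) e

σ-double : ∀ N → σ (2 * N) ≡ 2 * σ N + ∑ N (λ h → 𝟙[ suc (2 * h) ∣ 2 * N ] * suc (2 * h))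
σ-double N = begin
  σ (2 * N)                                          ≡⟨ σ≡∑ (2 * N) ⟩
  ∑ (2 * N) g + g (2 * N)                            ≡⟨ cong (_+ g (2 * N)) (∑-split-parity N g) ⟩
  ∑ N (λ h → g (2 * h)) + O + g (2 * N)              ≡⟨ +-assoc (∑ N (λ h → g (2 * h))) O _ ⟩
  ∑ N (λ h → g (2 * h)) + (O + g (2 * N))            ≡⟨ cong (∑ N (λ h → g (2 * h)) +_) (+-comm O _) ⟩
  ∑ N (λ h → g (2 * h)) + (g (2 * N) + O)            ≡⟨ +-assoc (∑ N (λ h → g (2 * h))) _ O ⟨
  ∑ (suc N) (λ h → g (2 * h)) + O                    ≡⟨ cong (_+ O) (∑-cong (suc N) (λ h _ → even-term h)) ⟩
  ∑ (suc N) (λ h → 2 * (𝟙[ h ∣ N ] * h)) + O         ≡⟨ cong (_+ O) (∑-*ˡ (suc N) 2 _) ⟩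
  2 * ∑ (suc N) (λ h → 𝟙[ h ∣ N ] * h) + O           ≡⟨ cong (λ s → 2 * s + O) (σ≡∑ N) ⟨
  2 * σ N + O                                        ∎
  where
  open ≡-Reasoning
  g : ℕ → ℕ
  g e = 𝟙[ e ∣ 2 * N ] * e
  O : ℕ
  O = ∑ N (λ h → g (suc (2 * h)))
  even-term : ∀ h → g (2 * h) ≡ 2 * (𝟙[ h ∣ N ] * h)
  even-term h = trans (cong (_* (2 * h)) (χ-cong ((0 <? 2 * h) ×-dec (2 * h ∣? 2 * N)) ((0 <? h) ×-dec (h ∣? N))
                                            (λ (2h>0 , 2h∣2N) → m*n>0⇒n>0 2 2h>0 , *-cancelˡ-∣ 2 2h∣2N)
                                            (λ (h>0 , h∣N) → *-monoʳ-< 2 h>0 , *-monoʳ-∣ 2 h∣N)))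
                      (solve 2 (λ x y → x :* (con 2 :* y) := con 2 :* (x :* y)) refl 𝟙[ h ∣ N ] h)

even⊎odd : ∀ n → ∃[ k ] (n ≡ 2 * k ⊎ n ≡ suc (2 * k))
even⊎odd zero = 0 , inj₁ refl
even⊎odd (suc n) with even⊎odd n
... | k , inj₁ refl = k , inj₂ refl
... | k , inj₂ refl = suc k , inj₁ (sym (*-suc 2 k))

2∤odd : ∀ h → ¬ 2 ∣ suc (2 * h)
2∤odd h (divides k eq) = even≢odd k h (trans (*-comm 2 k) (sym eq))

prime∤⇒coprime : ∀ {p m} → Prime p → ¬ p ∣ m → Coprime p m
prime∤⇒coprime p-prime p∤m (i∣p , i∣m) with prime⇒irreducible p-prime i∣p
... | inj₁ i≡1 = i≡1
... | inj₂ refl = contradiction i∣m p∤m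

coprime-∣-^⇒≡1 : ∀ {m p} k → Coprime m p → m ∣ p ^ k → m ≡ 1
coprime-∣-^⇒≡1 zero    _   m∣1    = ∣1⇒≡1 m∣1
coprime-∣-^⇒≡1 (suc k) m⊥p m∣p^sk = coprime-∣-^⇒≡1 k m⊥p (coprime-divisor m⊥p m∣p^sk)

odd⊥2 : ∀ h → Coprime (suc (2 * h)) 2
odd⊥2 h = Coprime.sym (prime∤⇒coprime prime[2] (2∤odd h))

2^⊥odd : ∀ k h → Coprime (2 ^ k) (suc (2 * h))
2^⊥odd k h {i} (i∣2^k , i∣odd) = coprime-∣-^⇒≡1 k (Coprime.sym (prime∤⇒coprime prime[2] 2∤i)) i∣2^k
  where
  2∤i : ¬ 2 ∣ i
  2∤i 2∣i = 2∤odd h (∣-trans 2∣i i∣odd)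

σ-2^-suc : ∀ a → σ (2 ^ suc a) ≡ suc (2 * σ (2 ^ a))
σ-2^-suc a = begin
  σ (2 * 2 ^ a)                                                          ≡⟨ σ-double (2 ^ a) ⟩
  2 * σ (2 ^ a) + ∑ (2 ^ a) (λ h → 𝟙[ suc (2 * h) ∣ 2 ^ suc a ] * suc (2 * h)) ≡⟨ cong (2 * σ (2 ^ a) +_) odd-part ⟩
  2 * σ (2 ^ a) + 1                                                      ≡⟨ +-comm _ 1 ⟩
  suc (2 * σ (2 ^ a))                                                    ∎
  where
  open ≡-Reasoning
  odd-term : ∀ h → 𝟙[ suc (2 * h) ∣ 2 ^ suc a ] * suc (2 * h) ≡ χ (h ≟ 0) * 1
  odd-term zero    = trans (*-identityʳ 𝟙[ 1 ∣ 2 ^ suc a ]) (𝟙-∣ z<s (1∣ (2 ^ suc a)))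
  odd-term (suc h) = cong (_* suc (2 * suc h)) (𝟙-∤ (λ d∣2^ → 0≢1+n (sym (suc-injective (coprime-∣-^⇒≡1 (suc a) (odd⊥2 (suc h)) d∣2^)))))
  odd-part : ∑ (2 ^ a) (λ h → 𝟙[ suc (2 * h) ∣ 2 ^ suc a ] * suc (2 * h)) ≡ 1
  odd-part = trans (∑-cong (2 ^ a) (λ h _ → odd-term h)) (∑-point (2 ^ a) 0 (λ _ → 1) (m^n>0 2 a))

suc-σ-2^ : ∀ a → suc (σ (2 ^ a)) ≡ 2 ^ suc a
suc-σ-2^ zero    = refl
suc-σ-2^ (suc a) = begin
  suc (σ (2 ^ suc a))      ≡⟨ cong suc (σ-2^-suc a) ⟩
  2 + 2 * σ (2 ^ a)        ≡⟨ *-suc 2 (σ (2 ^ a)) ⟨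
  2 * suc (σ (2 ^ a))      ≡⟨ cong (2 *_) (suc-σ-2^ a) ⟩
  2 * 2 ^ suc a            ∎
  where open ≡-Reasoning

σ-2^-odd : ∀ a → ∃[ s ] σ (2 ^ a) ≡ suc (2 * s)
σ-2^-odd zero    = 0 , refl
σ-2^-odd (suc a) = σ (2 ^ a) , σ-2^-suc a

-- Squares and the parity of σ

IsSquare : ℕ → Set
IsSquare m = ∃[ t ] t * t ≡ m

isSquare? : ∀ m → Dec (IsSquare m)
isSquare? m with anyUpTo? (λ t → t * t ≟ m) (suc m)
... | yes (t , _ , t²≡m) = yes (t , t²≡m)
... | no  none            = no λ (t , t²≡m) → none (t , s≤s (subst (t ≤_) t²≡m (n≤n*n t)) , t²≡m)

SquareOrTwiceSquare : ℕ → Set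
SquareOrTwiceSquare m = IsSquare m ⊎ IsSquare (2 * m)

squareOrTwiceSquare? : ∀ m → Dec (SquareOrTwiceSquare m)
squareOrTwiceSquare? m = isSquare? m ⊎-dec isSquare? (2 * m)

2-adic : ∀ m → 0 < m → ∃[ a ] ∃[ h ] m ≡ 2 ^ a * suc (2 * h)
2-adic = <-rec _ step
  where
  n<2*n : ∀ k → 0 < k → k < 2 * k
  n<2*n k k>0 = subst (k <_) (*-comm k 2) (m<m*n k 2 {{>-nonZero k>0}} (s≤s (s≤s z≤n)))
  step : ∀ m → (∀ {k} → k < m → 0 < k → ∃[ a ] ∃[ h ] k ≡ 2 ^ a * suc (2 * h)) →
         0 < m → ∃[ a ] ∃[ h ] m ≡ 2 ^ a * suc (2 * h)
  step m rec m>0 with even⊎odd m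
  ... | h , inj₂ m≡odd = 0 , h , trans m≡odd (sym (+-identityʳ _))
  ... | k , inj₁ refl with rec (n<2*n k (m*n>0⇒n>0 2 m>0)) (m*n>0⇒n>0 2 m>0)
  ...   | a , h , refl = suc a , h , sym (*-assoc 2 (2 ^ a) _)

𝟙≡#cofactors : ∀ {u} d → 0 < u → 𝟙[ d ∣ u ] ≡ ∑ (suc u) (λ e → χ (e * d ≟ u))
𝟙≡#cofactors {u} d u>0 with 𝟙-case d u
... | inj₁ 𝟙≡0 = trans 𝟙≡0 (sym (∑-zero (suc u) (λ e _ → χ-no (e * d ≟ u) (not-cofactor {e}))))
  where
  not-cofactor : ∀ {e} → e * d ≢ u
  not-cofactor {e} refl = 0≢1+n (trans (sym 𝟙≡0) (𝟙-∣ (m*n>0⇒n>0 e u>0) (n∣m*n e)))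
... | inj₂ (d>0 , divides q refl) = trans (𝟙-∣ d>0 (divides q refl)) (sym (trans
        (∑-cong (suc (q * d)) (λ e _ → χ-cong (e * d ≟ q * d) (e ≟ q) (*-cancelʳ-≡ e q d {{>-nonZero d>0}}) (cong (_* d))))
        (∑-χ-≟ (suc (q * d)) q (s≤s (m≤m*n q d {{>-nonZero d>0}})))))

∑-divisor-involution : ∀ {u} (f g : ℕ → ℕ) → 0 < u → (∀ d e → d * e ≡ u → f d ≡ g e) →
  ∑ (suc u) (λ d → 𝟙[ d ∣ u ] * f d) ≡ ∑ (suc u) (λ e → 𝟙[ e ∣ u ] * g e)
∑-divisor-involution {u} f g u>0 f≡g = begin
  ∑ (suc u) (λ d → 𝟙[ d ∣ u ] * f d)
    ≡⟨ ∑-cong (suc u) (λ d _ → trans (cong (_* f d) (𝟙≡#cofactors d u>0)) (sym (∑-*ʳ (suc u) (f d) _))) ⟩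
  ∑ (suc u) (λ d → ∑ (suc u) (λ e → χ (e * d ≟ u) * f d))
    ≡⟨ ∑-cong (suc u) (λ d _ → ∑-cong (suc u) (λ e _ → swap-term d e (e * d ≟ u))) ⟩
  ∑ (suc u) (λ d → ∑ (suc u) (λ e → χ (e * d ≟ u) * g e))
    ≡⟨ ∑-comm (suc u) (suc u) _ ⟩
  ∑ (suc u) (λ e → ∑ (suc u) (λ d → χ (e * d ≟ u) * g e))
    ≡⟨ ∑-cong (suc u) (λ e _ → trans (∑-*ʳ (suc u) (g e) _) (cong (_* g e) (sym (𝟙≡#cofactors′ e)))) ⟩
  ∑ (suc u) (λ e → 𝟙[ e ∣ u ] * g e) ∎
  where
  open ≡-Reasoning
  swap-term : ∀ d e (eq? : Dec (e * d ≡ u)) → χ eq? * f d ≡ χ eq? * g e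
  swap-term d e (yes ed≡u) = cong (1 *_) (f≡g d e (trans (*-comm d e) ed≡u))
  swap-term d e (no _)     = refl
  𝟙≡#cofactors′ : ∀ e → 𝟙[ e ∣ u ] ≡ ∑ (suc u) (λ d → χ (e * d ≟ u))
  𝟙≡#cofactors′ e = trans (𝟙≡#cofactors e u>0)
    (∑-cong (suc u) (λ d _ → χ-cong (d * e ≟ u) (e * d ≟ u) (trans (*-comm e d)) (trans (*-comm d e))))

τ : ℕ → ℕ
τ u = ∑ (suc u) (λ d → 𝟙[ d ∣ u ])

¬square⇒2∣τ : ∀ {u} → 0 < u → ¬ IsSquare u → 2 ∣ τ u
¬square⇒2∣τ {u} u>0 ¬□ = divides L (begin
  τ u                                                            ≡⟨ ∑-cong (suc u) (λ d _ → split d) ⟩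
  ∑ (suc u) (λ d → 𝟙[ d ∣ u ] * below d + 𝟙[ d ∣ u ] * above d) ≡⟨ ∑-distrib-+ (suc u) _ _ ⟩
  L + R                                                          ≡⟨ cong (L +_) L≡R ⟨
  L + L                                                          ≡⟨ solve 1 (λ l → l :+ l := l :* con 2) refl L ⟩
  L * 2                                                          ∎)
  where
  open ≡-Reasoning
  below above : ℕ → ℕ
  below d = χ (d * d <? u)
  above d = χ (u <? d * d)
  L R : ℕ
  L = ∑ (suc u) (λ d → 𝟙[ d ∣ u ] * below d)
  R = ∑ (suc u) (λ d → 𝟙[ d ∣ u ] * above d)
  below+above : ∀ d → below d + above d ≡ 1
  below+above d with <-cmp (d * d) u
  ... | tri< lt _  ¬gt = cong₂ _+_ (χ-yes (d * d <? u) lt) (χ-no (u <? d * d) ¬gt)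
  ... | tri≈ _  eq _   = contradiction (d , eq) ¬□
  ... | tri> ¬lt _ gt  = cong₂ _+_ (χ-no (d * d <? u) ¬lt) (χ-yes (u <? d * d) gt)
  split : ∀ d → 𝟙[ d ∣ u ] ≡ 𝟙[ d ∣ u ] * below d + 𝟙[ d ∣ u ] * above d
  split d = trans (sym (*-identityʳ 𝟙[ d ∣ u ]))
                  (trans (cong (𝟙[ d ∣ u ] *_) (sym (below+above d))) (*-distribˡ-+ 𝟙[ d ∣ u ] (below d) (above d)))
  below⇔above : ∀ d e → d * e ≡ u → below d ≡ above e
  below⇔above d e refl = χ-cong (d * d <? d * e) (d * e <? e * e)
    (λ dd<de → *-monoˡ-< e {{>-nonZero (m*n>0⇒n>0 d u>0)}} (*-cancelˡ-< d d e dd<de))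
    (λ de<ee → *-monoʳ-< d {{>-nonZero (m*n>0⇒m>0 d u>0)}} (*-cancelʳ-< e d e de<ee))
  L≡R : L ≡ R
  L≡R = ∑-divisor-involution below above u>0 below⇔above

∣odd⇒odd : ∀ {d h} → d ∣ suc (2 * h) → ∃[ k ] d ≡ suc (2 * k)
∣odd⇒odd {d} {h} d∣odd with even⊎odd d
... | k , inj₂ d≡odd = k , d≡odd
... | k , inj₁ refl  = contradiction (∣-trans (m∣m*n k) d∣odd) (2∤odd h)

2∣σ+τ-odd : ∀ h → 2 ∣ σ (suc (2 * h)) + τ (suc (2 * h))
2∣σ+τ-odd h = subst (2 ∣_) σ+τ≡∑ (∑-∣ (suc u) (λ d → 𝟙[ d ∣ u ] * d + 𝟙[ d ∣ u ]) even-term)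
  where
  u = suc (2 * h)
  σ+τ≡∑ : ∑ (suc u) (λ d → 𝟙[ d ∣ u ] * d + 𝟙[ d ∣ u ]) ≡ σ u + τ u
  σ+τ≡∑ = trans (∑-distrib-+ (suc u) _ _) (cong (_+ τ u) (sym (σ≡∑ u)))
  even-term : ∀ d → d < suc u → 2 ∣ 𝟙[ d ∣ u ] * d + 𝟙[ d ∣ u ]
  even-term d _ with 𝟙-case d u
  ... | inj₁ 𝟙≡0 = subst (λ x → 2 ∣ x * d + x) (sym 𝟙≡0) (2 ∣0)
  ... | inj₂ (d>0 , d∣u) with ∣odd⇒odd {h = h} d∣u
  ...   | k , refl = subst (λ x → 2 ∣ x * suc (2 * k) + x) (sym (𝟙-∣ d>0 d∣u))
                       (divides (suc k) (solve 1 (λ k → con 1 :* (con 1 :+ con 2 :* k) :+ con 1 := (con 1 :+ k) :* con 2) refl k))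

σ-odd⇒square-of-odd : ∀ h → ¬ 2 ∣ σ (suc (2 * h)) → IsSquare (suc (2 * h))
σ-odd⇒square-of-odd h σ-odd with isSquare? (suc (2 * h))
... | yes □ = □
... | no ¬□ = contradiction (∣m+n∣m⇒∣n (subst (2 ∣_) (+-comm _ (τ (suc (2 * h)))) (2∣σ+τ-odd h)) (¬square⇒2∣τ z<s ¬□)) σ-odd

σ-2^*odd : ∀ a h → σ (2 ^ a * suc (2 * h)) ≡ σ (2 ^ a) * σ (suc (2 * h))
σ-2^*odd a h = σ-*-coprime (m^n>0 2 a) z<s (2^⊥odd a h)

^-double : ∀ m k → m ^ (2 * k) ≡ m ^ k * m ^ k
^-double m k = trans (cong (λ j → m ^ (k + j)) (+-identityʳ k)) (^-distribˡ-+-* m k k)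

σ-odd⇒squareOrTwiceSquare : ∀ m → 0 < m → ¬ 2 ∣ σ m → SquareOrTwiceSquare m
σ-odd⇒squareOrTwiceSquare m m>0 σ-odd with 2-adic m m>0
... | a , h , refl with even⊎odd a | σ-odd⇒square-of-odd h (σ-odd ∘ subst (2 ∣_) (sym (σ-2^*odd a h)) ∘ ∣n⇒∣m*n (σ (2 ^ a)))
...   | k , inj₁ refl | t , t²≡u = inj₁ (2 ^ k * t , (begin
  2 ^ k * t * (2 ^ k * t)      ≡⟨ [m*n]*[o*p]≡[m*o]*[n*p] (2 ^ k) t (2 ^ k) t ⟩
  2 ^ k * 2 ^ k * (t * t)      ≡⟨ cong₂ _*_ (sym (^-double 2 k)) t²≡u ⟩
  2 ^ (2 * k) * suc (2 * h)    ∎))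
  where open ≡-Reasoning
...   | k , inj₂ refl | t , t²≡u = inj₂ (2 ^ suc k * t , (begin
  2 ^ suc k * t * (2 ^ suc k * t)         ≡⟨ [m*n]*[o*p]≡[m*o]*[n*p] (2 ^ suc k) t (2 ^ suc k) t ⟩
  2 ^ suc k * 2 ^ suc k * (t * t)         ≡⟨ cong₂ _*_ (sym (^-double 2 (suc k))) t²≡u ⟩
  2 ^ (2 * suc k) * suc (2 * h)           ≡⟨ cong (λ j → 2 ^ j * suc (2 * h)) (*-suc 2 k) ⟩
  2 * 2 ^ suc (2 * k) * suc (2 * h)       ≡⟨ *-assoc 2 (2 ^ suc (2 * k)) _ ⟩
  2 * (2 ^ suc (2 * k) * suc (2 * h))     ∎))
  where open ≡-Reasoning

-- Near superperfect numbers

-- With n = 2^(a+1) u, u odd, the factor q = σ (2^(a+1)) = 2^(a+2) − 1 of σ n is odd,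
-- so σ u = 2w and σ n = w · 2q; then σ (σ n) ≥ w σ (2q) = 3w σ q ≥ 3w 2^(a+2) > 3n.
3n<σσn : ∀ n → 0 < n → 2 ∣ n → 2 ∣ σ n → 3 * n < σ (σ n)
3n<σσn n n>0 2∣n 2∣σn with 2-adic n n>0
... | zero , h , refl = contradiction (subst (2 ∣_) (+-identityʳ _) 2∣n) (2∤odd h)
... | suc a , h , refl with σ-2^-odd (suc a)
...   | s , q≡odd = begin-strict
  3 * (2 ^ suc a * u)        <⟨ *-monoʳ-< 3 (*-monoʳ-< (2 ^ suc a) {{m^n≢0 2 (suc a)}} (n<1+n u)) ⟩
  3 * (2 ^ suc a * suc u)    ≤⟨ *-monoʳ-≤ 3 (*-monoʳ-≤ (2 ^ suc a) (σ-≥-suc u u≥2)) ⟩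
  3 * (2 ^ suc a * σ u)      ≡⟨ cong (λ x → 3 * (2 ^ suc a * x)) σu≡w*2 ⟩
  3 * (2 ^ suc a * (w * 2))  ≡⟨ solve 2 (λ x w → con 3 :* (x :* (w :* con 2)) := w :* (con 3 :* (con 2 :* x))) refl (2 ^ suc a) w ⟩
  w * (3 * 2 ^ suc (suc a))  ≡⟨ cong (λ x → w * (3 * x)) (suc-σ-2^ (suc a)) ⟨
  w * (3 * suc q)            ≤⟨ *-monoʳ-≤ w (*-monoʳ-≤ 3 (σ-≥-suc q q≥2)) ⟩
  w * (3 * σ q)              ≡⟨ cong (w *_) σ2q≡3σq ⟨
  w * σ (2 * q)              ≤⟨ *-σ-≤-σ-* w (2 * q) w>0 (*-monoʳ-< 2 q>0) ⟩
  σ (w * (2 * q))            ≡⟨ cong σ σn≡w*2q ⟨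
  σ (σ (2 ^ suc a * u))      ∎
  where
  open ≤-Reasoning
  u = suc (2 * h)
  q = σ (2 ^ suc a)
  2⊥q : Coprime 2 q
  2⊥q = subst (Coprime 2) (sym q≡odd) (Coprime.sym (odd⊥2 s))
  2∣σu : 2 ∣ σ u
  2∣σu = coprime-divisor 2⊥q (subst (2 ∣_) (σ-2^*odd (suc a) h) 2∣σn)
  w = quotient 2∣σu
  σu≡w*2 : σ u ≡ w * 2
  σu≡w*2 = _∣_.equality 2∣σu
  u≥2 : 2 ≤ u
  u≥2 = odd≥2 h 2∣σu
    where
    odd≥2 : ∀ h → 2 ∣ σ (suc (2 * h)) → 2 ≤ suc (2 * h)
    odd≥2 zero    2∣σ1 = contradiction 2∣σ1 (2∤odd 0)
    odd≥2 (suc _) _    = s≤s (s≤s z≤n)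
  w>0 : 0 < w
  w>0 = m*n>0⇒m>0 w (subst (0 <_) σu≡w*2 (≤-trans z<s (σ-≥-suc u u≥2)))
  q≥2 : 2 ≤ q
  q≥2 = ≤-pred (subst (3 ≤_) (sym (suc-σ-2^ (suc a))) (≤-trans (n≤1+n 3) (*-monoʳ-≤ 2 (*-monoʳ-≤ 2 (m^n>0 2 a)))))
  q>0 : 0 < q
  q>0 = <-trans z<s q≥2
  σ2q≡3σq : σ (2 * q) ≡ 3 * σ q
  σ2q≡3σq = σ-*-coprime z<s q>0 2⊥q
  σn≡w*2q : σ (2 ^ suc a * u) ≡ w * (2 * q)
  σn≡w*2q = trans (σ-2^*odd (suc a) h) (trans (cong (q *_) σu≡w*2)
                  (solve 2 (λ q w → q :* (w :* con 2) := w :* (con 2 :* q)) refl q w))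

nearSuperperfect⇒squareOrTwiceSquare : ∀ n → NearSuperperfect n → SquareOrTwiceSquare n ⊎ SquareOrTwiceSquare (σ n)
nearSuperperfect⇒squareOrTwiceSquare n (n>0 , d , d>0 , d∣n , 2n+d≡σσn) with 2 ∣? n | 2 ∣? σ n
... | no 2∤n | _ = inj₂ (σ-odd⇒squareOrTwiceSquare (σ n) (≤-trans n>0 (σ-≥ n)) σσn-odd)
  where
  σσn-odd : ¬ 2 ∣ σ (σ n)
  σσn-odd 2∣σσn = 2∤n (∣-trans (∣m+n∣m⇒∣n (subst (2 ∣_) (sym 2n+d≡σσn) 2∣σσn) (divides n (*-comm 2 n))) d∣n)
... | yes _   | no 2∤σn = inj₁ (σ-odd⇒squareOrTwiceSquare n n>0 2∤σn)
... | yes 2∣n | yes 2∣σn = contradiction (3n<σσn n n>0 2∣n 2∣σn) (≤⇒≯ σσn≤3n)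
  where
  σσn≤3n : σ (σ n) ≤ 3 * n
  σσn≤3n = begin
    σ (σ n)  ≡⟨ 2n+d≡σσn ⟨
    2 * n + d ≤⟨ +-monoʳ-≤ (2 * n) (∣⇒≤′ n>0 d∣n) ⟩
    2 * n + n ≡⟨ solve 1 (λ n → con 2 :* n :+ n := con 3 :* n) refl n ⟩
    3 * n    ∎
    where open ≤-Reasoning

-- Square classes and smooth numbers

m*m∣n*n⇒m∣n : ∀ m n → m * m ∣ n * n → m ∣ n
m*m∣n*n⇒m∣n zero    n 0∣n² = subst (0 ∣_) (sym (n*n≡0⇒n≡0 n (0∣⇒≡0 0∣n²))) ∣-refl
  where
  n*n≡0⇒n≡0 : ∀ n → n * n ≡ 0 → n ≡ 0
  n*n≡0⇒n≡0 zero _ = refl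
m*m∣n*n⇒m∣n (suc m) n m²∣n² with gcd-cofactors (suc m) n z<s
... | g , m′ , n′ , g>0 , m≡m′g , refl , m′⊥n′ = subst (_∣ n′ * g) (sym (trans m≡m′g (trans (cong (_* g) m′≡1) (*-identityˡ g)))) (n∣m*n n′)
  where
  instance
    g²≢0 : NonZero (g * g)
    g²≢0 = m*n≢0 g g {{>-nonZero g>0}} {{>-nonZero g>0}}
  m′²∣n′² : m′ * m′ ∣ n′ * n′
  m′²∣n′² = *-cancelʳ-∣ (g * g) (subst₂ _∣_ (trans (cong (λ x → x * x) m≡m′g) ([m*n]*[o*p]≡[m*o]*[n*p] m′ g m′ g))
                                            ([m*n]*[o*p]≡[m*o]*[n*p] n′ g n′ g) m²∣n²)
  m′≡1 : m′ ≡ 1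
  m′≡1 = m′⊥n′ (∣-refl , coprime-divisor m′⊥n′ (m*n∣⇒m∣ m′ m′ m′²∣n′²))

square-cancel : ∀ m c t → 0 < c → m * (c * c) ≡ t * t → IsSquare m
square-cancel m c t c>0 eq with m*m∣n*n⇒m∣n c t (divides m (sym eq))
... | divides z refl = z , *-cancelʳ-≡ (z * z) m (c * c) {{m*n≢0 c c {{>-nonZero c>0}} {{>-nonZero c>0}}}}
                             (trans (sym ([m*n]*[o*p]≡[m*o]*[n*p] z c z c)) (sym eq))

coprime-*-square⇒square : ∀ {a b s} → 0 < a → Coprime a b → a * b ≡ s * s → IsSquare a
coprime-*-square⇒square {a} {b} {s} a>0 a⊥b ab≡s² with gcd-cofactors a s a>0
... | g , a₁ , s₁ , g>0 , refl , refl , a₁⊥s₁ = a₁ , sym (cong (a₁ *_) (trans g≡ha₁ (trans (cong (_* a₁) h≡1) (*-identityˡ a₁))))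
  where
  instance
    g≢0 : NonZero g
    g≢0 = >-nonZero g>0
  a₁∣g : a₁ ∣ g
  a₁∣g = coprime-divisor a₁⊥s₁ (coprime-divisor a₁⊥s₁ (divides b (*-cancelʳ-≡ _ _ g (begin
    s₁ * (s₁ * g) * g    ≡⟨ solve 2 (λ s g → s :* (s :* g) :* g := s :* g :* (s :* g)) refl s₁ g ⟩
    s₁ * g * (s₁ * g)    ≡⟨ ab≡s² ⟨
    a₁ * g * b           ≡⟨ solve 3 (λ a g b → a :* g :* b := b :* a :* g) refl a₁ g b ⟩
    b * a₁ * g           ∎))))
    where open ≡-Reasoning
  h = quotient a₁∣g
  g≡ha₁ : g ≡ h * a₁
  g≡ha₁ = _∣_.equality a₁∣g
  b≡s₁s₁h : b ≡ s₁ * s₁ * h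
  b≡s₁s₁h = *-cancelˡ-≡ b (s₁ * s₁ * h) (a₁ * g) {{>-nonZero a>0}} (begin
    a₁ * g * b                       ≡⟨ ab≡s² ⟩
    s₁ * g * (s₁ * g)                ≡⟨ cong (λ x → s₁ * x * (s₁ * g)) g≡ha₁ ⟩
    s₁ * (h * a₁) * (s₁ * g)         ≡⟨ solve 4 (λ s h a g → s :* (h :* a) :* (s :* g) := a :* g :* (s :* s :* h)) refl s₁ h a₁ g ⟩
    a₁ * g * (s₁ * s₁ * h)           ∎)
    where open ≡-Reasoning
  h≡1 : h ≡ 1
  h≡1 = a⊥b (divides (a₁ * a₁) (trans (cong (a₁ *_) g≡ha₁) (solve 2 (λ a h → a :* (h :* a) := a :* a :* h) refl a₁ h)) ,
             divides (s₁ * s₁) b≡s₁s₁h)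

least-witness : ∀ {P : ℕ → Set} → Decidable P → ∀ {n} → P n → ∃[ k ] (P k × (∀ {j} → j < k → ¬ P j))
least-witness {P} P? {n} = <-rec (λ n → P n → ∃[ k ] (P k × (∀ {j} → j < k → ¬ P j))) smaller n
  where
  smaller : ∀ n → (∀ {m} → m < n → P m → ∃[ k ] (P k × (∀ {j} → j < k → ¬ P j))) → P n →
            ∃[ k ] (P k × (∀ {j} → j < k → ¬ P j))
  smaller n rec Pn with anyUpTo? P? n
  ... | yes (m , m<n , Pm) = rec m<n Pm
  ... | no  none           = n , Pn , λ j<n Pj → none (_ , j<n , Pj)

square-*-square : ∀ {j a c s r} → 0 < c → s * s ≡ j * c → r * r ≡ a * c → IsSquare (j * a)
square-*-square {j} {a} {c} {s} {r} c>0 s²≡jc r²≡ac = square-cancel (j * a) c (s * r) c>0 (begin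
  j * a * (c * c)      ≡⟨ [m*n]*[o*p]≡[m*o]*[n*p] j a c c ⟩
  j * c * (a * c)      ≡⟨ cong₂ _*_ s²≡jc r²≡ac ⟨
  s * s * (r * r)      ≡⟨ [m*n]*[o*p]≡[m*o]*[n*p] s r s r ⟨
  s * r * (s * r)      ∎)
  where open ≡-Reasoning

square-product⇒common-part : ∀ {j a} → 0 < j → 0 < a → IsSquare (j * a) →
  ∃[ g ] ∃[ w ] ∃[ v ] (0 < g × j ≡ w * w * g × a ≡ v * v * g)
square-product⇒common-part {j} {a} j>0 a>0 (z , z²≡ja) with gcd-cofactors j a j>0
... | g , j′ , a′ , g>0 , refl , refl , j′⊥a′
  with square-cancel (j′ * a′) g z g>0 (trans ([m*n]*[o*p]≡[m*o]*[n*p] j′ a′ g g) (sym z²≡ja))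
...   | z′ , z′²≡j′a′
  with coprime-*-square⇒square {s = z′} (m*n>0⇒m>0 j′ j>0) j′⊥a′ (sym z′²≡j′a′)
     | coprime-*-square⇒square {s = z′} (m*n>0⇒m>0 a′ a>0) (Coprime.sym j′⊥a′) (trans (*-comm a′ j′) (sym z′²≡j′a′))
...     | w , w²≡j′ | v , v²≡a′ = g , w , v , g>0 , cong (_* g) (sym w²≡j′) , cong (_* g) (sym v²≡a′)

-- a₀ is the least positive j with j c a square: any other such j shares its squarefree
-- part g with a₀, and minimality forces a₀ = g.
square-multiples : ∀ c → 0 < c → ∃[ a₀ ] (0 < a₀ × (∀ j → IsSquare (j * c) → ∃[ w ] j ≡ a₀ * (w * w)))
square-multiples c c>0 with least-witness (λ j → (0 <? j) ×-dec isSquare? (j * c)) (c>0 , c , refl)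
... | a₀ , (a₀>0 , r , r²≡a₀c) , minimal = a₀ , a₀>0 , classify
  where
  classify : ∀ j → IsSquare (j * c) → ∃[ w ] j ≡ a₀ * (w * w)
  classify zero      _             = 0 , sym (*-zeroʳ a₀)
  classify j@(suc _) (s , s²≡jc) with square-product⇒common-part z<s a₀>0 (square-*-square {j} {a₀} {c} {s} {r} c>0 s²≡jc r²≡a₀c)
  ... | g , w , v , g>0 , j≡w²g , a₀≡v²g = w , (begin
    j              ≡⟨ j≡w²g ⟩
    w * w * g      ≡⟨ *-comm (w * w) g ⟩
    g * (w * w)    ≡⟨ cong (_* (w * w)) a₀≡g ⟨
    a₀ * (w * w)   ∎)
    where
    open ≡-Reasoning
    gc-square : IsSquare (g * c)
    gc-square = square-cancel (g * c) v r (m*n>0⇒m>0 v (m*n>0⇒m>0 (v * v) (subst (0 <_) a₀≡v²g a₀>0))) (begin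
      g * c * (v * v)   ≡⟨ solve 3 (λ g c v → g :* c :* (v :* v) := v :* v :* g :* c) refl g c v ⟩
      v * v * g * c     ≡⟨ cong (_* c) a₀≡v²g ⟨
      a₀ * c            ≡⟨ r²≡a₀c ⟨
      r * r             ∎)
    a₀≤g : a₀ ≤ g
    a₀≤g = ≮⇒≥ (λ g<a₀ → minimal g<a₀ (g>0 , gc-square))
    a₀≡g : a₀ ≡ g
    a₀≡g = ≤-antisym a₀≤g (subst (g ≤_) (sym a₀≡v²g) (m≤n*m g (v * v) {{>-nonZero (m*n>0⇒m>0 (v * v) (subst (0 <_) a₀≡v²g a₀>0))}}))

m≤n⇒m∣n! : ∀ {m} n → 0 < m → m ≤ n → m ∣ n !
m≤n⇒m∣n! {suc m} n _ 1+m≤n = ∣-trans (m∣m*n (m !)) (m≤n⇒m!∣n! 1+m≤n)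

prime-factor : ∀ n → 2 ≤ n → ∃[ p ] (Prime p × p ∣ n)
prime-factor n@(suc _) n≥2 with factorise n
... | record { factors = [] ; isFactorisation = n≡1 } = contradiction n≡1 (>⇒≢ n≥2)
... | record { factors = p ∷ ps ; isFactorisation = n≡p*∏ ; factorsPrime = p-prime ∷ _ } =
  p , p-prime , divides (product ps) (trans n≡p*∏ (*-comm p (product ps)))

coprime-∣⇒*-∣ : ∀ {m n o} → Coprime m n → m ∣ o → n ∣ o → m * n ∣ o
coprime-∣⇒*-∣ {m} {n} m⊥n m∣o (divides t refl) with coprime-divisor m⊥n (subst (m ∣_) (*-comm t n) m∣o)
... | divides t′ refl = divides t′ (*-assoc t′ m n)

squarefree-smooth⇒∣! : ∀ Y n → 0 < n → (∀ p → Prime p → p ∣ n → p ≤ Y) → (∀ i → 2 ≤ i → ¬ i * i ∣ n) → n ∣ Y !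
squarefree-smooth⇒∣! Y = <-rec _ step
  where
  step : ∀ n → (∀ {m} → m < n → 0 < m → (∀ p → Prime p → p ∣ m → p ≤ Y) → (∀ i → 2 ≤ i → ¬ i * i ∣ m) → m ∣ Y !) →
         0 < n → (∀ p → Prime p → p ∣ n → p ≤ Y) → (∀ i → 2 ≤ i → ¬ i * i ∣ n) → n ∣ Y !
  step 1 _ _ _ _ = 1∣ (Y !)
  step n@(suc (suc _)) rec n>0 smooth squarefree with prime-factor n (s≤s (s≤s z≤n))
  ... | p , p-prime , divides m n≡mp = subst (_∣ Y !) (trans (*-comm p m) (sym n≡mp)) (coprime-∣⇒*-∣ p⊥m p∣Y! m∣Y!)
    where
    p>1 : 1 < p
    p>1 = nonTrivial⇒n>1 p {{prime⇒nonTrivial p-prime}}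
    m∣n : m ∣ n
    m∣n = divides p (trans n≡mp (*-comm m p))
    m>0 : 0 < m
    m>0 = m*n>0⇒m>0 m (subst (0 <_) n≡mp n>0)
    p⊥m : Coprime p m
    p⊥m = prime∤⇒coprime p-prime (λ p∣m → squarefree p p>1 (subst (p * p ∣_) (sym n≡mp) (*-monoˡ-∣ p p∣m)))
    p∣Y! : p ∣ Y !
    p∣Y! = m≤n⇒m∣n! Y (<-trans z<s p>1) (smooth p p-prime (divides m n≡mp))
    m∣Y! : m ∣ Y !
    m∣Y! = rec (subst (m <_) (sym n≡mp) (m<m*n m p {{>-nonZero m>0}} p>1)) m>0
               (λ q q-prime q∣m → smooth q q-prime (∣-trans q∣m m∣n))
               (λ i i≥2 i²∣m → squarefree i i≥2 (∣-trans i²∣m m∣n))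

m*n≤o⇒m≤o/n : ∀ m n o .{{_ : NonZero n}} → m * n ≤ o → m ≤ o / n
m*n≤o⇒m≤o/n m n o mn≤o = subst (_≤ o / n) (m*n/n≡m m n) (/-monoˡ-≤ n mn≤o)

smooth-bound : ∀ Y Q n → 0 < n → (∀ p → Prime p → p ∣ n → p ≤ Y) → (∀ i → i * i ∣ n → i * i ≤ Q) → n ≤ Y ! * Q
smooth-bound Y Q n = <-rec SmoothBound step n Q
  where
  SmoothBound : ℕ → Set
  SmoothBound n = ∀ Q → 0 < n → (∀ p → Prime p → p ∣ n → p ≤ Y) → (∀ i → i * i ∣ n → i * i ≤ Q) → n ≤ Y ! * Q
  step : ∀ n → (∀ {m} → m < n → SmoothBound m) → SmoothBound n
  step n rec Q n>0 smooth squares≤Q with anyUpTo? (λ i → (2 ≤? i) ×-dec (i * i ∣? n)) (suc n)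
  ... | no none = ≤-trans (∣⇒≤′ (>-nonZero⁻¹ (Y !) {{Y !≢0}}) n∣Y!) (m≤m*n (Y !) Q {{>-nonZero Q>0}})
    where
    Q>0 : 0 < Q
    Q>0 = squares≤Q 1 (1∣ n)
    n∣Y! : n ∣ Y !
    n∣Y! = squarefree-smooth⇒∣! Y n n>0 smooth
             (λ i i≥2 i²∣n → none (i , s≤s (≤-trans (n≤n*n i) (∣⇒≤′ n>0 i²∣n)) , i≥2 , i²∣n))
  ... | yes (i , _ , i≥2 , divides k n≡ki²) = begin
    n                              ≡⟨ n≡ki² ⟩
    k * (i * i)                    ≤⟨ *-monoˡ-≤ (i * i) (rec k<n (Q / (i * i)) k>0 smooth-k squares-k) ⟩
    Y ! * (Q / (i * i)) * (i * i)  ≡⟨ *-assoc (Y !) _ _ ⟩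
    Y ! * (Q / (i * i) * (i * i))  ≤⟨ *-monoʳ-≤ (Y !) (m/n*n≤m Q (i * i)) ⟩
    Y ! * Q                        ∎
    where
    open ≤-Reasoning
    instance
      i²≢0 : NonZero (i * i)
      i²≢0 = m*n≢0 i i {{i≢0}} {{i≢0}}
        where
        i≢0 : NonZero i
        i≢0 = >-nonZero (<-trans z<s i≥2)
    k∣n : k ∣ n
    k∣n = divides (i * i) (trans n≡ki² (*-comm k (i * i)))
    k>0 : 0 < k
    k>0 = m*n>0⇒m>0 k (subst (0 <_) n≡ki² n>0)
    k<n : k < n
    k<n = subst (k <_) (sym n≡ki²) (m<m*n k (i * i) {{>-nonZero k>0}} (≤-trans i≥2 (n≤n*n i)))
    smooth-k : ∀ p → Prime p → p ∣ k → p ≤ Y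
    smooth-k p p-prime p∣k = smooth p p-prime (∣-trans p∣k k∣n)
    squares-k : ∀ j → j * j ∣ k → j * j ≤ Q / (i * i)
    squares-k j j²∣k = m*n≤o⇒m≤o/n (j * j) (i * i) Q (subst (_≤ Q) ([m*n]*[o*p]≡[m*o]*[n*p] j i j i)
      (squares≤Q (j * i) (subst (_∣ n) (sym ([m*n]*[o*p]≡[m*o]*[n*p] j i j i)) (subst (j * j * (i * i) ∣_) (sym n≡ki²) (*-monoˡ-∣ (i * i) j²∣k)))))

-- Counting

#multiples≤ : ∀ a .{{_ : NonZero a}} N X → ∑ N (λ k → χ (0 <? k) * χ (k * a ≤? X)) ≤ X / a
#multiples≤ a N X = begin
  ∑ N (λ k → χ (0 <? k) * χ (k * a ≤? X))                ≤⟨ ∑-≤-support N (X / a) beyond ⟩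
  ∑ (suc (X / a)) (λ k → χ (0 <? k) * χ (k * a ≤? X))    ≤⟨ ∑-mono-≤ (suc (X / a)) (λ k _ → m*n≤m (χ (0 <? k)) (χ≤1 (k * a ≤? X))) ⟩
  ∑ (suc (X / a)) (λ k → χ (0 <? k))                     ≡⟨ ∑-χ-0< (X / a) ⟩
  X / a                                                  ∎
  where
  open ≤-Reasoning
  m*n≤m : ∀ m {n} → n ≤ 1 → m * n ≤ m
  m*n≤m m n≤1 = ≤-trans (*-monoʳ-≤ m n≤1) (≤-reflexive (*-identityʳ m))
  beyond : ∀ k → X / a < k → χ (0 <? k) * χ (k * a ≤? X) ≡ 0
  beyond k X/a<k = trans (cong (χ (0 <? k) *_) (χ-no (k * a ≤? X) (<⇒≱ X/a<k ∘ m*n≤o⇒m≤o/n k a X))) (*-zeroʳ (χ (0 <? k)))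

∑-split-at : ∀ W M (B : ℕ → ℕ) → (∀ y → B y ≤ 1) →
  ∑ M (λ w → χ (0 <? w) * B (w * w)) ≤ W + ∑ M (λ w → χ (W <? w) * B (w * w))
∑-split-at W M B B≤1 = begin
  ∑ M (λ w → χ (0 <? w) * B (w * w))
    ≤⟨ ∑-mono-≤ M (λ w _ → small-or-large w) ⟩
  ∑ M (λ w → χ (0 <? w) * χ (w * 1 ≤? W) + χ (W <? w) * B (w * w))
    ≡⟨ ∑-distrib-+ M _ _ ⟩
  ∑ M (λ w → χ (0 <? w) * χ (w * 1 ≤? W)) + ∑ M (λ w → χ (W <? w) * B (w * w))
    ≤⟨ +-monoˡ-≤ _ (≤-trans (#multiples≤ 1 M W) (≤-reflexive (n/1≡n W))) ⟩
  W + ∑ M (λ w → χ (W <? w) * B (w * w)) ∎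
  where
  open ≤-Reasoning
  small-or-large : ∀ w → χ (0 <? w) * B (w * w) ≤ χ (0 <? w) * χ (w * 1 ≤? W) + χ (W <? w) * B (w * w)
  small-or-large w with w ≤? W
  ... | yes w≤W = ≤-trans (*-monoʳ-≤ (χ (0 <? w)) (≤-trans (B≤1 (w * w))
                                                           (≤-reflexive (sym (χ-yes (w * 1 ≤? W) (subst (_≤ W) (sym (*-identityʳ w)) w≤W))))))
                          (m≤m+n _ _)
  ... | no  w≰W = ≤-trans (≤-trans (*-monoˡ-≤ (B (w * w)) (χ≤1 (0 <? w)))
                                   (≤-reflexive (trans (*-identityˡ _) (sym (χ-*-yes (W <? w) (≰⇒> w≰W) _)))))
                          (m≤n+m _ _)

#squares≤ : ∀ W .{{_ : NonZero W}} X N → ∑ N (λ w → χ (0 <? w) * χ (w * w ≤? X)) ≤ W + X / W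
#squares≤ W X N = begin
  ∑ N (λ w → χ (0 <? w) * χ (w * w ≤? X))       ≤⟨ ∑-split-at W N (λ y → χ (y ≤? X)) (λ y → χ≤1 (y ≤? X)) ⟩
  W + ∑ N (λ w → χ (W <? w) * χ (w * w ≤? X))   ≤⟨ +-monoʳ-≤ W (∑-mono-≤ N (λ w _ → large w (W <? w))) ⟩
  W + ∑ N (λ w → χ (0 <? w) * χ (w * W ≤? X))   ≤⟨ +-monoʳ-≤ W (#multiples≤ W N X) ⟩
  W + X / W                                     ∎
  where
  open ≤-Reasoning
  large : ∀ w (W<w? : Dec (W < w)) → χ W<w? * χ (w * w ≤? X) ≤ χ (0 <? w) * χ (w * W ≤? X)
  large w (yes W<w) = begin
    1 * χ (w * w ≤? X)             ≡⟨ *-identityˡ _ ⟩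
    χ (w * w ≤? X)                 ≤⟨ χ-mono (w * w ≤? X) (w * W ≤? X) (≤-trans (*-monoʳ-≤ w (<⇒≤ W<w))) ⟩
    χ (w * W ≤? X)                 ≡⟨ χ-*-yes (0 <? w) (<-≤-trans z<s W<w) _ ⟨
    χ (0 <? w) * χ (w * W ≤? X)    ∎
  large w (no _)    = z≤n

X/[v+1]²+X/[v+1]≤X/v : ∀ v X .{{_ : NonZero v}} → X / (suc v * suc v) + X / suc v ≤ X / v
X/[v+1]²+X/[v+1]≤X/v v X = m*n≤o⇒m≤o/n (A + B) v X (begin
  (A + B) * v       ≡⟨ *-distribʳ-+ v A B ⟩
  A * v + B * v     ≤⟨ +-monoˡ-≤ (B * v) (≤-trans (*-monoʳ-≤ A (n≤1+n v)) A[v+1]≤B) ⟩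
  B + B * v         ≡⟨ *-suc B v ⟨
  B * suc v         ≤⟨ m/n*n≤m X (suc v) ⟩
  X                 ∎)
  where
  open ≤-Reasoning
  A = X / (suc v * suc v)
  B = X / suc v
  A[v+1]≤B : A * suc v ≤ B
  A[v+1]≤B = m*n≤o⇒m≤o/n (A * suc v) (suc v) X (subst (_≤ X) (sym (*-assoc A (suc v) (suc v))) (m/n*n≤m X (suc v * suc v)))

∑-tail-telescope : ∀ V X N → ∑ N (λ j → X / (suc (suc V + j) * suc (suc V + j))) + X / (suc V + N) ≤ X / suc V
∑-tail-telescope V X zero    = ≤-reflexive (/-congʳ {m = X} (+-identityʳ (suc V)))
∑-tail-telescope V X (suc N) = begin
  ∑ N t + t N + X / (suc V + suc N)   ≡⟨ cong (∑ N t + t N +_) (/-congʳ {m = X} (+-suc (suc V) N)) ⟩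
  ∑ N t + t N + X / suc v             ≡⟨ +-assoc (∑ N t) (t N) _ ⟩
  ∑ N t + (t N + X / suc v)           ≤⟨ +-monoʳ-≤ (∑ N t) (X/[v+1]²+X/[v+1]≤X/v v X) ⟩
  ∑ N t + X / v                       ≤⟨ ∑-tail-telescope V X N ⟩
  X / suc V                           ∎
  where
  open ≤-Reasoning
  v = suc V + N
  t : ℕ → ℕ
  t j = X / (suc (suc V + j) * suc (suc V + j))

∑-tail≤ : ∀ V X M (h : ℕ → ℕ) → (∀ w → suc V < w → h w * (w * w) ≤ X) →
          ∑ M (λ w → χ (suc V <? w) * h w) ≤ X / suc V
∑-tail≤ V X M h h[w]w²≤X = begin
  ∑ M f                                               ≤⟨ ∑-monoˡ-≤ f (m≤n+m M (suc (suc V))) ⟩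
  ∑ (suc (suc V) + M) f                               ≡⟨ ∑-+ (suc (suc V)) M f ⟩
  ∑ (suc (suc V)) f + ∑ M (λ j → f (suc (suc V) + j))
    ≡⟨ cong₂ _+_ head-vanishes (∑-cong M (λ j _ → χ-*-yes (suc V <? _) (s≤s (s≤s (m≤m+n V j))) _)) ⟩
  ∑ M (λ j → h (suc (suc V + j)))                     ≤⟨ ∑-mono-≤ M (λ j _ → m*n≤o⇒m≤o/n _ _ X (h[w]w²≤X _ (s≤s (s≤s (m≤m+n V j))))) ⟩
  ∑ M (λ j → X / (suc (suc V + j) * suc (suc V + j))) ≤⟨ m≤m+n _ (X / (suc V + M)) ⟩
  _                                                   ≤⟨ ∑-tail-telescope V X M ⟩
  X / suc V                                           ∎
  where
  open ≤-Reasoning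
  f : ℕ → ℕ
  f w = χ (suc V <? w) * h w
  head-vanishes : ∑ (suc (suc V)) f ≡ 0
  head-vanishes = ∑-zero (suc (suc V)) (λ w w<2+V → χ-*-no (suc V <? w) (<⇒≱ w<2+V) (h w))

∑-square-multiples≤ : ∀ c → 0 < c → ∀ N (B : ℕ → ℕ) → (∀ {m n} → m ≤ n → B n ≤ B m) →
  ∑ N (λ j → χ (isSquare? (suc j * c)) * B (suc j)) ≤ ∑ (suc N) (λ w → χ (0 <? w) * B (w * w))
∑-square-multiples≤ c c>0 N B antitone with square-multiples c c>0
... | a₀ , a₀>0 , classify = begin
  ∑ N (λ j → χ (isSquare? (suc j * c)) * B (suc j))       ≤⟨ ∑-mono-≤ N (λ j j<N → to-root j j<N) ⟩
  ∑ N (λ j → ∑ (suc N) (λ w → χ (suc j ≟ a₀ * (w * w)) * G w)) ≡⟨ ∑-comm N (suc N) _ ⟩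
  ∑ (suc N) (λ w → ∑ N (λ j → χ (suc j ≟ a₀ * (w * w)) * G w)) ≡⟨ ∑-cong (suc N) (λ w _ → ∑-*ʳ N (G w) _) ⟩
  ∑ (suc N) (λ w → ∑ N (λ j → χ (suc j ≟ a₀ * (w * w))) * G w) ≤⟨ ∑-mono-≤ (suc N) (λ w _ → *-monoˡ-≤ (G w) (at-most-one w)) ⟩
  ∑ (suc N) (λ w → 1 * G w)                                ≡⟨ ∑-cong (suc N) (λ w _ → *-identityˡ (G w)) ⟩
  ∑ (suc N) G                                              ∎
  where
  open ≤-Reasoning
  G : ℕ → ℕ
  G w = χ (0 <? w) * B (w * w)
  at-most-one : ∀ w → ∑ N (λ j → χ (suc j ≟ a₀ * (w * w))) ≤ 1
  at-most-one w = ≤-trans (∑-mono-≤ N (λ j _ → χ-mono (suc j ≟ a₀ * (w * w)) (j ≟ pred (a₀ * (w * w))) (cong pred)))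
                          (∑-χ-≟-≤ N (pred (a₀ * (w * w))))
  to-root : ∀ j → j < N → χ (isSquare? (suc j * c)) * B (suc j) ≤ ∑ (suc N) (λ w → χ (suc j ≟ a₀ * (w * w)) * G w)
  to-root j j<N with isSquare? (suc j * c)
  ... | no  _ = z≤n
  ... | yes □ with classify (suc j) □
  ...   | zero  , 1+j≡0 = contradiction (trans 1+j≡0 (*-zeroʳ a₀)) 1+n≢0
  ...   | w@(suc _) , 1+j≡a₀w² = begin
    1 * B (suc j)                          ≡⟨ *-identityˡ (B (suc j)) ⟩
    B (suc j)                              ≤⟨ antitone w²≤1+j ⟩
    B (w * w)                              ≡⟨ χ-*-yes (0 <? w) z<s (B (w * w)) ⟨
    G w                                    ≡⟨ χ-*-yes (suc j ≟ a₀ * (w * w)) 1+j≡a₀w² (G w) ⟨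
    χ (suc j ≟ a₀ * (w * w)) * G w
      ≤⟨ f≤∑ (suc N) (λ w → χ (suc j ≟ a₀ * (w * w)) * G w) (s≤s (≤-trans (n≤n*n w) (≤-trans w²≤1+j j<N))) ⟩
    ∑ (suc N) (λ w → χ (suc j ≟ a₀ * (w * w)) * G w) ∎
    where
    w²≤1+j : w * w ≤ suc j
    w²≤1+j = subst (w * w ≤_) (sym 1+j≡a₀w²) (m≤n*m (w * w) a₀ {{>-nonZero a₀>0}})

#square-multiples≤ : ∀ W .{{_ : NonZero W}} c → 0 < c → ∀ x → ∑ (suc x) (λ n → χ (isSquare? (c * n))) ≤ 1 + (W + x / W)
#square-multiples≤ W c c>0 x = begin
  ∑ (suc x) (λ n → χ (isSquare? (c * n)))                        ≡⟨ ∑-+ 1 x _ ⟩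
  χ (isSquare? (c * 0)) + ∑ x (λ j → χ (isSquare? (c * suc j)))   ≤⟨ +-mono-≤ (χ≤1 (isSquare? (c * 0))) (∑-mono-≤ x (λ j j<x → bounded j j<x)) ⟩
  1 + ∑ x (λ j → χ (isSquare? (suc j * c)) * B (suc j))
    ≤⟨ +-monoʳ-≤ 1 (∑-square-multiples≤ c c>0 x B (λ m≤n → χ-mono (_ ≤? x) (_ ≤? x) (≤-trans m≤n))) ⟩
  1 + ∑ (suc x) (λ w → χ (0 <? w) * χ (w * w ≤? x))              ≤⟨ +-monoʳ-≤ 1 (#squares≤ W x (suc x)) ⟩
  1 + (W + x / W)                                                ∎
  where
  open ≤-Reasoning
  B : ℕ → ℕ
  B y = χ (y ≤? x)
  bounded : ∀ j → j < x → χ (isSquare? (c * suc j)) ≤ χ (isSquare? (suc j * c)) * B (suc j)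
  bounded j j<x = subst (χ (isSquare? (c * suc j)) ≤_) (sym (trans (cong (χ (isSquare? (suc j * c)) *_) (χ-yes (suc j ≤? x) j<x)) (*-identityʳ _)))
                        (χ-mono (isSquare? (c * suc j)) (isSquare? (suc j * c)) (subst IsSquare (*-comm c (suc j))))

#squareOrTwiceSquare≤ : ∀ W .{{_ : NonZero W}} x → ∑ (suc x) (λ n → χ (squareOrTwiceSquare? n)) ≤ 2 * (1 + (W + x / W))
#squareOrTwiceSquare≤ W x = begin
  ∑ (suc x) (λ n → χ (squareOrTwiceSquare? n))                          ≤⟨ ∑-mono-≤ (suc x) (λ n _ → χ-⊎ (isSquare? n) (isSquare? (2 * n))) ⟩
  ∑ (suc x) (λ n → χ (isSquare? n) + χ (isSquare? (2 * n)))             ≡⟨ ∑-distrib-+ (suc x) _ _ ⟩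
  ∑ (suc x) (λ n → χ (isSquare? n)) + ∑ (suc x) (λ n → χ (isSquare? (2 * n)))
    ≡⟨ cong (_+ ∑ (suc x) (λ n → χ (isSquare? (2 * n)))) (∑-cong (suc x) (λ n _ → 1*n n)) ⟩
  ∑ (suc x) (λ n → χ (isSquare? (1 * n))) + ∑ (suc x) (λ n → χ (isSquare? (2 * n)))
    ≤⟨ +-mono-≤ (#square-multiples≤ W 1 z<s x) (#square-multiples≤ W 2 z<s x) ⟩
  S + S                                                                ≡⟨ cong (S +_) (+-identityʳ S) ⟨
  2 * S                                                                ∎
  where
  open ≤-Reasoning
  S = 1 + (W + x / W)
  1*n : ∀ n → χ (isSquare? n) ≡ χ (isSquare? (1 * n))
  1*n n = χ-cong (isSquare? n) (isSquare? (1 * n)) (subst IsSquare (sym (*-identityˡ n))) (subst IsSquare (*-identityˡ n))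

#multiples*≤ : ∀ a N X → ∑ N (λ k → χ (0 <? k) * χ (k * a ≤? X)) * a ≤ X
#multiples*≤ zero      N X = subst (_≤ X) (sym (*-zeroʳ (∑ N (λ k → χ (0 <? k) * χ (k * 0 ≤? X))))) z≤n
#multiples*≤ a@(suc _) N X = ≤-trans (*-monoˡ-≤ a (#multiples≤ a N X)) (m/n*n≤m X a)

-- The density estimate

module Estimate (V : ℕ) where

  W Y C : ℕ
  W = 2 + V
  Y = W * W
  C = Y ! * Y

  W<Y : W < Y
  W<Y = m<m*n W W (s≤s (s≤s z≤n))

  K : ℕ
  K = 2 + 2 * W + suc C

  module _ (x : ℕ) where

    largeSquareDivisor : ℕ → ℕ
    largeSquareDivisor = fibre (λ i k → k * (i * i)) (λ i k → χ (W <? i) * χ (0 <? k)) (suc x)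

    largePrimeWeight : ℕ → ℕ → ℕ
    largePrimeWeight k p = χ ((0 <? k) ×-dec (k * Y ≤? x)) * (χ (isSquare? (suc p * σ k)) + χ (isSquare? (suc p * (2 * σ k))))

    largePrimeFactor : ℕ → ℕ
    largePrimeFactor = fibre (λ k p → p * k) largePrimeWeight (suc x)

    square-divisor-hit : ∀ {n i k} → n ≤ x → 0 < n → W < i → n ≡ k * (i * i) → 1 ≤ largeSquareDivisor n
    square-divisor-hit {n} {i} {k} n≤x n>0 W<i n≡ki² =
      ≤-fibre _ _ (suc x) (s≤s (≤-trans (n≤n*n i) (≤-trans (m≤n*m (i * i) k {{>-nonZero k>0}}) (subst (_≤ x) n≡ki² n≤x))))
                          (s≤s (≤-trans (m≤m*n k (i * i) {{>-nonZero (*-mono-< i>0 i>0)}}) (subst (_≤ x) n≡ki² n≤x)))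
                          n≡ki²
                          (≤-reflexive (sym (trans (cong (_* χ (0 <? k)) (χ-yes (W <? i) W<i)) (trans (*-identityˡ _) (χ-yes (0 <? k) k>0)))))
      where
      i>0 : 0 < i
      i>0 = ≤-trans (s≤s z≤n) W<i
      k>0 : 0 < k
      k>0 = m*n>0⇒m>0 k (subst (0 <_) n≡ki² n>0)

    large-prime-hit : ∀ {n p k} → n ≤ x → 0 < n → Prime p → Y ≤ p → n ≡ k * p → ¬ p * p ∣ n →
                      SquareOrTwiceSquare (σ n) → 1 ≤ largePrimeFactor n
    large-prime-hit {n} {p} {k} n≤x n>0 p-prime Y≤p n≡kp p²∤n □σn =
      ≤-fibre _ _ (suc x) (s≤s (≤-trans (m≤m*n k p {{>-nonZero p>0}}) kp≤x)) (s≤s (≤-trans (m≤n*m p k {{>-nonZero k>0}}) kp≤x))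
              (trans n≡kp (*-comm k p)) (subst (1 ≤_) (sym (χ-*-yes ((0 <? k) ×-dec (k * Y ≤? x)) (k>0 , kY≤x) _)) (squares≥1 □σn))
      where
      kp≤x : k * p ≤ x
      kp≤x = subst (_≤ x) n≡kp n≤x
      p>0 : 0 < p
      p>0 = <-trans z<s (nonTrivial⇒n>1 p {{prime⇒nonTrivial p-prime}})
      k>0 : 0 < k
      k>0 = m*n>0⇒m>0 k (subst (0 <_) n≡kp n>0)
      kY≤x : k * Y ≤ x
      kY≤x = ≤-trans (*-monoʳ-≤ k Y≤p) kp≤x
      p∤k : ¬ p ∣ k
      p∤k p∣k = p²∤n (subst (p * p ∣_) (sym n≡kp) (*-monoˡ-∣ p p∣k))
      σn≡[p+1]σk : σ n ≡ suc p * σ k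
      σn≡[p+1]σk = begin
        σ n           ≡⟨ cong σ (trans n≡kp (*-comm k p)) ⟩
        σ (p * k)     ≡⟨ σ-*-coprime p>0 k>0 (prime∤⇒coprime p-prime p∤k) ⟩
        σ p * σ k     ≡⟨ cong (_* σ k) (σ-prime p-prime) ⟩
        suc p * σ k   ∎
        where open ≡-Reasoning
      squares≥1 : SquareOrTwiceSquare (σ n) → 1 ≤ χ (isSquare? (suc p * σ k)) + χ (isSquare? (suc p * (2 * σ k)))
      squares≥1 (inj₁ □) = ≤-trans (≤-reflexive (sym (χ-yes (isSquare? _) (subst IsSquare σn≡[p+1]σk □)))) (m≤m+n _ _)
      squares≥1 (inj₂ □) = ≤-trans (≤-reflexive (sym (χ-yes (isSquare? _) (subst IsSquare 2σn≡ □)))) (m≤n+m _ _)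
        where
        2σn≡ : 2 * σ n ≡ suc p * (2 * σ k)
        2σn≡ = trans (cong (2 *_) σn≡[p+1]σk) (solve 2 (λ p s → con 2 :* (p :* s) := p :* (con 2 :* s)) refl (suc p) (σ k))

    smooth-case : ∀ {n} → 0 < n → (∀ p → Prime p → p ∣ n → p < Y) → (∀ i → i * i ∣ n → i ≤ W) → n ≤ C
    smooth-case {n} n>0 small-primes small-squares =
      smooth-bound Y Y n n>0 (λ p p-prime p∣n → <⇒≤ (small-primes p p-prime p∣n))
                             (λ i i²∣n → *-mono-≤ (small-squares i i²∣n) (small-squares i i²∣n))

    cover : ∀ n → n ≤ x → 0 < n → SquareOrTwiceSquare (σ n) → 1 ≤ largeSquareDivisor n + largePrimeFactor n + χ (n ≤? C)
    cover n n≤x n>0 □σn with anyUpTo? (λ i → (W <? i) ×-dec (i * i ∣? n)) (suc x)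
    ... | yes (i , _ , W<i , divides k n≡ki²) =
      ≤-trans (square-divisor-hit {k = k} n≤x n>0 W<i n≡ki²) (≤-trans (m≤m+n (largeSquareDivisor n) (largePrimeFactor n)) (m≤m+n _ (χ (n ≤? C))))
    ... | no no-square with anyUpTo? (λ p → prime? p ×-dec (Y ≤? p) ×-dec (p ∣? n)) (suc x)
    ...   | yes (p , _ , p-prime , Y≤p , divides k n≡kp) =
      ≤-trans (large-prime-hit {k = k} n≤x n>0 p-prime Y≤p n≡kp p²∤n □σn)
              (≤-trans (m≤n+m (largePrimeFactor n) (largeSquareDivisor n)) (m≤m+n _ (χ (n ≤? C))))
      where
      p²∤n : ¬ p * p ∣ n
      p²∤n p²∣n = no-square (p , s≤s (≤-trans (∣⇒≤′ n>0 (divides k n≡kp)) n≤x) , <-≤-trans W<Y Y≤p , p²∣n)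
    ...   | no no-prime = ≤-trans (≤-reflexive (sym (χ-yes (n ≤? C) (smooth-case n>0 small-primes small-squares))))
                                  (m≤n+m (χ (n ≤? C)) (largeSquareDivisor n + largePrimeFactor n))
      where
      small-primes : ∀ p → Prime p → p ∣ n → p < Y
      small-primes p p-prime p∣n = ≰⇒> (λ Y≤p → no-prime (p , s≤s (≤-trans (∣⇒≤′ n>0 p∣n) n≤x) , p-prime , Y≤p , p∣n))
      small-squares : ∀ i → i * i ∣ n → i ≤ W
      small-squares i i²∣n = ≮⇒≥ (λ W<i → no-square (i , s≤s (≤-trans (n≤n*n i) (≤-trans (∣⇒≤′ n>0 i²∣n) n≤x)) , W<i , i²∣n))

    ∑largeSquareDivisor≤ : ∑ (suc x) largeSquareDivisor ≤ x / W
    ∑largeSquareDivisor≤ = begin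
      ∑ (suc x) largeSquareDivisor
        ≡⟨ ∑-fibre x _ _ (suc x) ⟩
      ∑ (suc x) (λ i → ∑ (suc x) (λ k → χ (k * (i * i) ≤? x) * (χ (W <? i) * χ (0 <? k))))
        ≡⟨ ∑-cong (suc x) (λ i _ → trans (∑-cong (suc x) (λ k _ → x∙yz≈y∙zx (χ (k * (i * i) ≤? x)) (χ (W <? i)) (χ (0 <? k))))
                                          (∑-*ˡ (suc x) (χ (W <? i)) _)) ⟩
      ∑ (suc x) (λ i → χ (W <? i) * ∑ (suc x) (λ k → χ (0 <? k) * χ (k * (i * i) ≤? x)))
        ≤⟨ ∑-tail≤ (suc V) x (suc x) _ (λ i _ → #multiples*≤ (i * i) (suc x) x) ⟩
      x / W ∎
      where open ≤-Reasoning

    fits : ℕ → ℕ → ℕ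
    fits k y = χ (k * y ≤? 2 * x)

    largeRoots : ℕ → ℕ
    largeRoots k = ∑ (suc (suc x)) (λ w → χ (W <? w) * fits k (w * w))

    #primes≤ : ∀ k c → 0 < c → k ≤ x → ∑ (suc x) (λ p → χ (p * k ≤? x) * χ (isSquare? (suc p * c))) ≤ W + largeRoots k
    #primes≤ k c c>0 k≤x = begin
      ∑ (suc x) (λ p → χ (p * k ≤? x) * χ (isSquare? (suc p * c)))      ≤⟨ ∑-mono-≤ (suc x) (λ p _ → fits-next p) ⟩
      ∑ (suc x) (λ p → χ (isSquare? (suc p * c)) * fits k (suc p))
        ≤⟨ ∑-square-multiples≤ c c>0 (suc x) (fits k) (λ m≤n → χ-mono (_ ≤? 2 * x) (_ ≤? 2 * x) (≤-trans (*-monoʳ-≤ k m≤n))) ⟩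
      ∑ (suc (suc x)) (λ w → χ (0 <? w) * fits k (w * w))               ≤⟨ ∑-split-at W (suc (suc x)) (fits k) (λ y → χ≤1 (k * y ≤? 2 * x)) ⟩
      W + largeRoots k                                                  ∎
      where
      open ≤-Reasoning
      fits-next : ∀ p → χ (p * k ≤? x) * χ (isSquare? (suc p * c)) ≤ χ (isSquare? (suc p * c)) * fits k (suc p)
      fits-next p = subst (_≤ χ (isSquare? (suc p * c)) * fits k (suc p)) (*-comm (χ (isSquare? (suc p * c))) (χ (p * k ≤? x)))
        (*-monoʳ-≤ (χ (isSquare? (suc p * c)))
        (χ-mono (p * k ≤? x) (k * suc p ≤? 2 * x) (λ pk≤x → begin
          k * suc p     ≡⟨ *-suc k p ⟩
          k + k * p     ≤⟨ +-mono-≤ k≤x (subst (_≤ x) (*-comm p k) pk≤x) ⟩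
          x + x         ≡⟨ cong (x +_) (+-identityʳ x) ⟨
          2 * x         ∎)))

    smallCofactor : ℕ → ℕ
    smallCofactor k = χ ((0 <? k) ×-dec (k * Y ≤? x))

    ∑largePrimeWeight≤ : ∀ k → ∑ (suc x) (λ p → χ (p * k ≤? x) * largePrimeWeight k p) ≤ smallCofactor k * (2 * (W + largeRoots k))
    ∑largePrimeWeight≤ k = begin
      ∑ (suc x) (λ p → χ (p * k ≤? x) * (smallCofactor k * (S₁ p + S₂ p)))
        ≡⟨ ∑-cong (suc x) (λ p _ → solve 4 (λ a b s t → a :* (b :* (s :+ t)) := b :* (a :* s :+ a :* t)) refl
                                          (χ (p * k ≤? x)) (smallCofactor k) (S₁ p) (S₂ p)) ⟩
      ∑ (suc x) (λ p → smallCofactor k * (χ (p * k ≤? x) * S₁ p + χ (p * k ≤? x) * S₂ p))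
        ≡⟨ ∑-*ˡ (suc x) (smallCofactor k) _ ⟩
      smallCofactor k * ∑ (suc x) (λ p → χ (p * k ≤? x) * S₁ p + χ (p * k ≤? x) * S₂ p)
        ≤⟨ χ-*-monoʳ-≤ ((0 <? k) ×-dec (k * Y ≤? x)) both ⟩
      smallCofactor k * (2 * (W + largeRoots k)) ∎
      where
      open ≤-Reasoning
      S₁ S₂ : ℕ → ℕ
      S₁ p = χ (isSquare? (suc p * σ k))
      S₂ p = χ (isSquare? (suc p * (2 * σ k)))
      both : 0 < k × k * Y ≤ x → ∑ (suc x) (λ p → χ (p * k ≤? x) * S₁ p + χ (p * k ≤? x) * S₂ p) ≤ 2 * (W + largeRoots k)
      both (k>0 , kY≤x) = begin
        ∑ (suc x) (λ p → χ (p * k ≤? x) * S₁ p + χ (p * k ≤? x) * S₂ p)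
          ≡⟨ ∑-distrib-+ (suc x) _ _ ⟩
        ∑ (suc x) (λ p → χ (p * k ≤? x) * S₁ p) + ∑ (suc x) (λ p → χ (p * k ≤? x) * S₂ p)
          ≤⟨ +-mono-≤ (#primes≤ k (σ k) σk>0 k≤x) (#primes≤ k (2 * σ k) (*-monoʳ-< 2 σk>0) k≤x) ⟩
        (W + largeRoots k) + (W + largeRoots k)
          ≡⟨ cong ((W + largeRoots k) +_) (+-identityʳ (W + largeRoots k)) ⟨
        2 * (W + largeRoots k) ∎
        where
        σk>0 : 0 < σ k
        σk>0 = ≤-trans k>0 (σ-≥ k)
        k≤x : k ≤ x
        k≤x = ≤-trans (m≤m*n k Y) kY≤x

    smallCofactor≡χ*χ : ∀ k → smallCofactor k ≡ χ (0 <? k) * χ (k * Y ≤? x)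
    smallCofactor≡χ*χ k = χ-× (0 <? k) (k * Y ≤? x)

    ∑smallCofactor*W≤ : ∑ (suc x) (λ k → smallCofactor k * W) ≤ x / Y * W
    ∑smallCofactor*W≤ = begin
      ∑ (suc x) (λ k → smallCofactor k * W)   ≡⟨ ∑-*ʳ (suc x) W smallCofactor ⟩
      ∑ (suc x) smallCofactor * W            ≡⟨ cong (_* W) (∑-cong (suc x) (λ k _ → smallCofactor≡χ*χ k)) ⟩
      _                                      ≤⟨ *-monoˡ-≤ W (#multiples≤ Y (suc x) x) ⟩
      x / Y * W                              ∎
      where open ≤-Reasoning

    ∑smallCofactor*largeRoots≤ : ∑ (suc x) (λ k → smallCofactor k * largeRoots k) ≤ (2 * x) / W
    ∑smallCofactor*largeRoots≤ = begin
      ∑ (suc x) (λ k → smallCofactor k * largeRoots k)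
        ≤⟨ ∑-mono-≤ (suc x) (λ k _ → *-monoˡ-≤ (largeRoots k) (subst (_≤ χ (0 <? k)) (sym (smallCofactor≡χ*χ k))
                                                          (≤-trans (*-monoʳ-≤ (χ (0 <? k)) (χ≤1 (k * Y ≤? x))) (≤-reflexive (*-identityʳ _))))) ⟩
      ∑ (suc x) (λ k → χ (0 <? k) * largeRoots k)
        ≡⟨ ∑-cong (suc x) (λ k _ → sym (∑-*ˡ (suc (suc x)) (χ (0 <? k)) _)) ⟩
      ∑ (suc x) (λ k → ∑ (suc (suc x)) (λ w → χ (0 <? k) * (χ (W <? w) * fits k (w * w))))
        ≡⟨ ∑-comm (suc x) (suc (suc x)) _ ⟩
      ∑ (suc (suc x)) (λ w → ∑ (suc x) (λ k → χ (0 <? k) * (χ (W <? w) * fits k (w * w))))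
        ≡⟨ ∑-cong (suc (suc x)) (λ w _ → trans (∑-cong (suc x) (λ k _ → x∙yz≈y∙xz (χ (0 <? k)) (χ (W <? w)) _))
                                               (∑-*ˡ (suc x) (χ (W <? w)) _)) ⟩
      ∑ (suc (suc x)) (λ w → χ (W <? w) * ∑ (suc x) (λ k → χ (0 <? k) * χ (k * (w * w) ≤? 2 * x)))
        ≤⟨ ∑-tail≤ (suc V) (2 * x) (suc (suc x)) _ (λ w _ → #multiples*≤ (w * w) (suc x) (2 * x)) ⟩
      (2 * x) / W ∎
      where open ≤-Reasoning

    ∑largePrimeFactor≤ : ∑ (suc x) largePrimeFactor ≤ 2 * (x / Y * W + (2 * x) / W)
    ∑largePrimeFactor≤ = begin
      ∑ (suc x) largePrimeFactor
        ≡⟨ ∑-fibre x _ _ (suc x) ⟩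
      ∑ (suc x) (λ k → ∑ (suc x) (λ p → χ (p * k ≤? x) * largePrimeWeight k p))
        ≤⟨ ∑-mono-≤ (suc x) (λ k _ → ∑largePrimeWeight≤ k) ⟩
      ∑ (suc x) (λ k → smallCofactor k * (2 * (W + largeRoots k)))
        ≡⟨ ∑-cong (suc x) (λ k _ → solve 3 (λ c w t → c :* (con 2 :* (w :+ t)) := con 2 :* (c :* w :+ c :* t)) refl (smallCofactor k) W (largeRoots k)) ⟩
      ∑ (suc x) (λ k → 2 * (smallCofactor k * W + smallCofactor k * largeRoots k))
        ≡⟨ ∑-*ˡ (suc x) 2 _ ⟩
      2 * ∑ (suc x) (λ k → smallCofactor k * W + smallCofactor k * largeRoots k)
        ≡⟨ cong (2 *_) (∑-distrib-+ (suc x) _ _) ⟩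
      2 * (∑ (suc x) (λ k → smallCofactor k * W) + ∑ (suc x) (λ k → smallCofactor k * largeRoots k))
        ≤⟨ *-monoʳ-≤ 2 (+-mono-≤ ∑smallCofactor*W≤ ∑smallCofactor*largeRoots≤) ⟩
      2 * (x / Y * W + (2 * x) / W) ∎
      where open ≤-Reasoning

    ∑small≤ : ∑ (suc x) (λ n → χ (n ≤? C)) ≤ suc C
    ∑small≤ = begin
      ∑ (suc x) (λ n → χ (n ≤? C))   ≤⟨ ∑-≤-support (suc x) C (λ n C<n → χ-no (n ≤? C) (<⇒≱ C<n)) ⟩
      ∑ (suc C) (λ n → χ (n ≤? C))   ≤⟨ ∑-≤-const (suc C) 1 (λ n _ → χ≤1 (n ≤? C)) ⟩
      suc C * 1                      ≡⟨ *-identityʳ (suc C) ⟩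
      suc C                          ∎
      where open ≤-Reasoning

    countNSP≤ : countNSP x ≤ 2 * (1 + (W + x / W)) + (x / W + 2 * (x / Y * W + (2 * x) / W) + suc C)
    countNSP≤ = begin
      countNSP x
        ≡⟨ length-filter-upTo nearSuperperfect? (suc x) ⟩
      ∑ (suc x) (λ n → χ (nearSuperperfect? n))
        ≤⟨ ∑-mono-≤ (suc x) (λ n _ → nsp≤ n) ⟩
      ∑ (suc x) (λ n → χ (squareOrTwiceSquare? n) + χ ((0 <? n) ×-dec squareOrTwiceSquare? (σ n)))
        ≡⟨ ∑-distrib-+ (suc x) _ _ ⟩
      ∑ (suc x) (λ n → χ (squareOrTwiceSquare? n)) + ∑ (suc x) (λ n → χ ((0 <? n) ×-dec squareOrTwiceSquare? (σ n)))
        ≤⟨ +-mono-≤ (#squareOrTwiceSquare≤ W x) (∑-mono-≤ (suc x) (λ n n≤x → χ-≤ _ (λ (n>0 , □σn) → cover n (≤-pred n≤x) n>0 □σn))) ⟩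
      2 * (1 + (W + x / W)) + ∑ (suc x) (λ n → largeSquareDivisor n + largePrimeFactor n + χ (n ≤? C))
        ≡⟨ cong (2 * (1 + (W + x / W)) +_) (trans (∑-distrib-+ (suc x) _ _)
             (cong (_+ ∑ (suc x) (λ n → χ (n ≤? C))) (∑-distrib-+ (suc x) largeSquareDivisor largePrimeFactor))) ⟩
      2 * (1 + (W + x / W)) + (∑ (suc x) largeSquareDivisor + ∑ (suc x) largePrimeFactor + ∑ (suc x) (λ n → χ (n ≤? C)))
        ≤⟨ +-monoʳ-≤ (2 * (1 + (W + x / W))) (+-mono-≤ (+-mono-≤ ∑largeSquareDivisor≤ ∑largePrimeFactor≤) ∑small≤) ⟩
      2 * (1 + (W + x / W)) + (x / W + 2 * (x / Y * W + (2 * x) / W) + suc C) ∎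
      where
      open ≤-Reasoning
      nsp≤ : ∀ n → χ (nearSuperperfect? n) ≤ χ (squareOrTwiceSquare? n) + χ ((0 <? n) ×-dec squareOrTwiceSquare? (σ n))
      nsp≤ n = χ-≤ (nearSuperperfect? n) λ nsp → case nearSuperperfect⇒squareOrTwiceSquare n nsp of λ where
        (inj₁ □n)  → ≤-trans (≤-reflexive (sym (χ-yes (squareOrTwiceSquare? n) □n))) (m≤m+n _ _)
        (inj₂ □σn) → ≤-trans (≤-reflexive (sym (χ-yes ((0 <? n) ×-dec squareOrTwiceSquare? (σ n)) (proj₁ nsp , □σn)))) (m≤n+m _ _)

    W*countNSP≤ : W * countNSP x ≤ 9 * x + W * K
    W*countNSP≤ = begin
      W * countNSP x
        ≤⟨ *-monoʳ-≤ W countNSP≤ ⟩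
      W * (2 * (1 + (W + x / W)) + (x / W + 2 * (x / Y * W + (2 * x) / W) + suc C))
        ≡⟨ solve 5 (λ w a b c d → w :* (con 2 :* (con 1 :+ (w :+ a)) :+ (a :+ con 2 :* (b :* w :+ c) :+ (con 1 :+ d)))
                               := w :* (con 2 :+ con 2 :* w :+ (con 1 :+ d)) :+ (con 3 :* (w :* a) :+ con 2 :* (b :* (w :* w)) :+ con 2 :* (w :* c)))
                   refl W (x / W) (x / Y) ((2 * x) / W) C ⟩
      W * K + (3 * (W * (x / W)) + 2 * (x / Y * Y) + 2 * (W * ((2 * x) / W)))
        ≤⟨ +-monoʳ-≤ (W * K) (+-mono-≤ (+-mono-≤ (*-monoʳ-≤ 3 (W*[X/W]≤X x)) (*-monoʳ-≤ 2 (m/n*n≤m x Y))) (*-monoʳ-≤ 2 (W*[X/W]≤X (2 * x)))) ⟩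
      W * K + (3 * x + 2 * x + 2 * (2 * x))
        ≡⟨ solve 2 (λ k x → k :+ (con 3 :* x :+ con 2 :* x :+ con 2 :* (con 2 :* x)) := con 9 :* x :+ k) refl (W * K) x ⟩
      9 * x + W * K ∎
      where
      open ≤-Reasoning
      W*[X/W]≤X : ∀ X → W * (X / W) ≤ X
      W*[X/W]≤X X = subst (_≤ X) (*-comm (X / W) W) (m/n*n≤m X W)

mainTheorem6 : (k : ℕ) → 0 < k → ∃[ N ] ((x : ℕ) → N ≤ x → k * countNSP x ≤ x)
mainTheorem6 (suc k) _ = W * K , bound
  where
  open Estimate (16 + 18 * k) -- W = 18 (suc k)
  bound : ∀ x → W * K ≤ x → suc k * countNSP x ≤ x
  bound x WK≤x = *-cancelˡ-≤ 18 (begin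
    18 * (suc k * countNSP x)   ≡⟨ *-assoc 18 (suc k) (countNSP x) ⟨
    18 * suc k * countNSP x     ≡⟨ cong (_* countNSP x) (*-suc 18 k) ⟩
    W * countNSP x              ≤⟨ W*countNSP≤ x ⟩
    9 * x + W * K               ≤⟨ +-monoʳ-≤ (9 * x) WK≤x ⟩
    9 * x + x                   ≤⟨ +-monoˡ-≤ x (*-monoˡ-≤ x (m≤m+n 9 8)) ⟩
    17 * x + x                  ≡⟨ +-comm (17 * x) x ⟩
    18 * x                      ∎)
    where open ≤-Reasoning
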